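{- Let $t=\bigvee(t^0,\dots,t^k)$ and $z=\bigvee(z^0,\dots,z^h)$ be planar rooted trees of degree $\ge1$. In $k[\mathcal T_\infty]$: (2) $t\succ z=\bigvee(t*z^0,z^1,\dots,z^h)$; (3) $t\cdot z=\bigvee(t^0,\dots,t^{k-1},t^k*z^0,z^1,\dots,z^h)$; (4) $t\prec z=\bigvee(t^0,\dots,t^{k-1},t^k*z)$; where $\bigvee$ is extended multilinearly, and for arbitrary trees $u,v$, $u*v=u\succ v+u\cdot v+u\prec v$ if both have degree $\ge1$, while (1) $u*\downarrow=u=\downarrow*u$.
   Context: $k$ is a field. $\mathcal P_n$ ($n\ge1$): surjective maps $\gamma:\{1,\dots,n\}\to\{1,\dots,r\}$, $r\ge1$; $\mathcal P_{n,r}$ those with image $\{1,\dots,r\}$; $\mathcal P_0=\{(0)\}$; composition is composition of maps. For $\gamma\in\mathcal P_{n,r}$, $\delta\in\mathcal P_{m,s}$: $\gamma\times\delta=(\gamma(1),\dots,\gamma(n),\delta(1)+r,\dots,\delta(m)+r)$. $SH(r,s)$: $\omega\in\mathcal P_{r+s}$ with $\omega(1)<\dots<\omega(r)$, $\omega(r+1)<\dots<\omega(r+s)$; $SH^{\succ},SH^{\bullet},SH^{\prec}$ its subsets with $\omega(r)<,=,>\omega(r+s)$. Trees: planar rooted trees with every vertex having $\ge2$ ordered inputs; $\mathcal T_n$ those with $n+1$ leaves (degree $n$), $\mathcal T_0=\{\downarrow\}$; every $t\ne\downarrow$ is uniquely $\bigvee(t^0,\dots,t^k)$ ($k\ge1$),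 the trees $t^0,\dots,t^k$ with roots joined in order to a new root vertex. $k[\mathcal T_\infty]$ is the vector space with basis all trees. $\Gamma$: $\Gamma((0))=\downarrow$; for $\gamma\in\mathcal P_{n,r}$ with $\gamma^{ -1}(r)=\{j_1<\dots<j_k\}$, $j_0=0$, $j_{k+1}=n+1$, $\gamma_i$ is $\gamma$ restricted to $\{j_i+1,\dots,j_{i+1}-1\}$ (reindexed from 1) with image relabeled order-preservingly onto $\{1,\dots,r_i\}$ ($(0)$ if empty), and $\Gamma(\gamma)=\bigvee(\Gamma(\gamma_0),\dots,\Gamma(\gamma_k))$. For trees $t,z$ of degree $\ge1$, $t\succ z$ is the sum (each term once) of all trees $w$ for which there exist $\gamma\in\Gamma^{ -1}(t)\cap\mathcal P_{n,r}$, $\delta\in\Gamma^{ -1}(z)\cap\mathcal P_{m,s}$ and $\sigma\in SH^{\succ}(r,s)$ with $\Gamma(\sigma\circ(\gamma\times\delta))=w$; $t\cdot z$ and $t\prec z$ are defined likewise with $SH^{\bullet}(r,s)$, $SH^{\prec}(r,s)$. -}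

module Defs where

open import Level using (_⊔_)
open import Data.Nat as ℕ using (ℕ; zero; suc; _+_; _∸_; _<_; _≤_; _≤?_; _⊔_)
open import Data.List using (List; []; _∷_; _++_; map; length; take; drop; foldr; filter; deduplicate)
open import Data.List.Relation.Unary.All using (All)
open import Data.List.Relation.Unary.Linked using (Linked)
open import Data.List.Membership.Propositional using (_∈_)
open import Data.Product using (Σ; Σ-syntax; _×_; _,_)
open import Data.Empty using (⊥)
open import Relation.Nullary using (¬_; Dec; yes; no)
open import Relation.Nullary.Decidable using (⌊_⌋)
open import Relation.Binary.PropositionalEquality using (_≡_; refl)
open import Data.Bool using (if_then_else_)
open import Algebra.Bundles using (CommutativeRing)

record Field (c ℓ : Level.Level) : Set (Level.suc (c Level.⊔ ℓ)) where
  field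
    commutativeRing : CommutativeRing c ℓ
  open CommutativeRing commutativeRing public
  field
    0≉1     : ¬ (0# ≈ 1#)
    inverse : ∀ x → ¬ (x ≈ 0#) → Σ[ y ∈ Carrier ] (x * y ≈ 1#)

-- Planar rooted trees, every vertex with ≥ 2 ordered inputs.
-- leaf is ↓ ; ⋁ t₀ t₁ [t₂,…,t_k] is ⋁(t⁰,…,tᵏ) with k ≥ 1.

data Tree : Set where
  leaf : Tree
  ⋁    : Tree → Tree → List Tree → Tree

infix 4 _≟ᵀ_ _≟ᴸ_
_≟ᵀ_ : (a b : Tree) → Dec (a ≡ b)
_≟ᴸ_ : (as bs : List Tree) → Dec (as ≡ bs)
leaf ≟ᵀ leaf = yes refl
leaf ≟ᵀ ⋁ _ _ _ = no λ ()
⋁ _ _ _ ≟ᵀ leaf = no λ ()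
⋁ a b cs ≟ᵀ ⋁ a' b' cs' with a ≟ᵀ a' | b ≟ᵀ b' | cs ≟ᴸ cs'
... | yes refl | yes refl | yes refl = yes refl
... | no ne | _ | _ = no λ { refl → ne refl }
... | yes _ | no ne | _ = no λ { refl → ne refl }
... | yes _ | yes _ | no ne = no λ { refl → ne refl }
[] ≟ᴸ [] = yes refl
[] ≟ᴸ (_ ∷ _) = no λ ()
(_ ∷ _) ≟ᴸ [] = no λ ()
(a ∷ as) ≟ᴸ (b ∷ bs) with a ≟ᵀ b | as ≟ᴸ bs
... | yes refl | yes refl = yes refl
... | no ne | _ = no λ { refl → ne refl }
... | yes _ | no ne = no λ { refl → ne refl }

-- ⋁ applied to a list of trees (only ever used on lists of length ≥ 2)
mkNode : List Tree → Tree
mkNode (a ∷ b ∷ cs) = ⋁ a b cs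
mkNode _            = leaf

-- Maps γ : {1..n} → {1..r} as the list (γ(1),…,γ(n)).
-- The element (0) of 𝒫₀ is the empty list (with r = 0).

Surj : List ℕ → ℕ → Set
Surj γ r = All (λ x → 1 ≤ x × x ≤ r) γ × (∀ j → 1 ≤ j → j ≤ r → j ∈ γ)

-- value γ(i) (1-based; 0 outside the domain)
app : List ℕ → ℕ → ℕ
app []      _             = 0
app (x ∷ _) 1             = x
app (_ ∷ xs) (suc (suc i)) = app xs (suc i)
app (_ ∷ _) zero          = 0

_∘ₚ_ : List ℕ → List ℕ → List ℕ
σ ∘ₚ τ = map (app σ) τ

-- γ × δ, where r is the size of the image of γ
_×[_]_ : List ℕ → ℕ → List ℕ → List ℕ
γ ×[ r ] δ = γ ++ map (_+ r) δ

maxL : List ℕ → ℕ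
maxL = foldr ℕ._⊔_ 0

splitOn : ℕ → List ℕ → List (List ℕ)
splitOn m [] = [] ∷ []
splitOn m (x ∷ xs) with x ℕ.≟ m | splitOn m xs
... | yes _ | segs     = [] ∷ segs
... | no _  | []       = (x ∷ []) ∷ []
... | no _  | seg ∷ segs = (x ∷ seg) ∷ segs

standardize : List ℕ → List ℕ
standardize γ = map (λ v → length (filter (_≤? v) (deduplicate ℕ._≟_ γ))) γ

Γf : ℕ → List ℕ → Tree
Γf zero    _        = leaf
Γf (suc f) []       = leaf
Γf (suc f) (x ∷ xs) =
  mkNode (map (λ seg → Γf f (standardize seg)) (splitOn (maxL (x ∷ xs)) (x ∷ xs)))

Γ : List ℕ → Tree
Γ γ = Γf (length γ) γ

Increasing : List ℕ → Set
Increasing = Linked _<_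

SH : ℕ → ℕ → List ℕ → Set
SH r s ω = (Σ[ q ∈ ℕ ] Surj ω q) × length ω ≡ r + s
         × Increasing (take r ω) × Increasing (drop r ω)

data Op : Set where
  ≻op ·op ≺op : Op

Cmp : Op → ℕ → ℕ → Set
Cmp ≻op a b = a < b
Cmp ·op a b = a ≡ b
Cmp ≺op a b = b < a

SHop : Op → ℕ → ℕ → List ℕ → Set
SHop op r s ω = SH r s ω × Cmp op (app ω r) (app ω (r + s))

-- w occurs (with coefficient 1) in  t ≻ z / t · z / t ≺ z
InSet : Op → Tree → Tree → Tree → Set
InSet op t z w =
  Σ[ γ ∈ List ℕ ] Σ[ r ∈ ℕ ] Σ[ δ ∈ List ℕ ] Σ[ s ∈ ℕ ] Σ[ σ ∈ List ℕ ]
    (Surj γ r × Γ γ ≡ t × Surj δ s × Γ δ ≡ z × SHop op r s σ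
     × Γ (σ ∘ₚ (γ ×[ r ] δ)) ≡ w)

-- Vectors of k[𝒯∞], given by their coefficient functions.

module Lin {c ℓ} (F : Field c ℓ) where
  open Field F using (Carrier; _≈_; 0#; 1#) renaming (_+_ to _+ₖ_; _*_ to _*ₖ_)

  V : Set c
  V = Tree → Carrier

  infix 4 _≈ᵥ_
  _≈ᵥ_ : V → V → Set ℓ
  u ≈ᵥ v = ∀ w → u w ≈ v w

  infixl 6 _+ᵥ_
  _+ᵥ_ : V → V → V
  (u +ᵥ v) w = u w +ₖ v w

  bas : Tree → V
  bas t w = if ⌊ w ≟ᵀ t ⌋ then 1# else 0#

  -- v is the sum (each term once) of the trees satisfying P
  IsIndicator : (Tree → Set) → V → Set ℓ
  IsIndicator P v = ∀ w → (P w → v w ≈ 1#) × (¬ P w → v w ≈ 0#)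

  -- multilinear extension of ⋁ : coefficient of ⋁(w₀,…,w_m) in
  -- ⋁(A₀,…,A_m) is ∏ Aᵢ(wᵢ); other trees get coefficient 0.
  coeffs : List V → List Tree → Carrier
  coeffs []       []       = 1#
  coeffs (A ∷ As) (w ∷ ws) = A w *ₖ coeffs As ws
  coeffs _        _        = 0#

  ⋁ᵥ : List V → V
  ⋁ᵥ As leaf        = 0#
  ⋁ᵥ As (⋁ a b cs) = coeffs As (a ∷ b ∷ cs)

  -- u * v, given the vectors I op u v of u ≻ v, u · v, u ≺ v
  star : (Op → Tree → Tree → V) → Tree → Tree → V
  star I leaf v                      = bas v
  star I u@(⋁ _ _ _) leaf            = bas u
  star I u@(⋁ _ _ _) v@(⋁ _ _ _) = I ≻op u v +ᵥ I ·op u v +ᵥ I ≺op u v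

-- Γ only depends on the relative order of the letters, so it extends to
-- arbitrary words: the children of the tree of u are the trees of the segments
-- between the occurrences of max u.  A shuffle σ ∈ SH(r,s) turns γ × δ
-- into a concatenation uv of order-preserving relabellings of γ and δ, every
-- concatenation of words of t and z arises in this way, and σ(r) compares to
-- σ(r+s) as max u to max v.  So t ≻ z, t · z and t ≺ z are the trees of the
-- concatenations uv with max u < max v, max u = max v and max u > max v.
-- Cutting uv at its maximum, u is absorbed by the first segment of v in the first
-- case, the last segment of u meets the first segment of v in the second, and v
-- is absorbed by the last segment of u in the third.  The children are therefore
-- (y, z¹, …, zʰ), (t⁰, …, t^{k-1}, y, z¹, …, zʰ) and (t⁰, …, t^{k-1}, y), where y
-- is the tree of a concatenation of words of t and z⁰, of tᵏ and z⁰, of tᵏ and z,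
-- i.e. a term of t * z⁰, tᵏ * z⁰, tᵏ * z; since every tree has a word, all these
-- shapes occur.  Comparing the leaf counts of first children and the numbers of
-- children shows that the three products have disjoint supports, so t * z is the
-- indicator of their union, and membership is decidable by recursion on leaf
-- counts: the identities of supports therefore become identities of vectors.

{-# OPTIONS --safe #-}
module Submission where

open import Defs
open import Level using (Level)
open import Function using (id; _∘_; _⇔_; mk⇔; Equivalence)
open import Function.Properties.Equivalence using () renaming (sym to ⇔-sym)
open import Data.Sum using (_⊎_; inj₁; inj₂)
open import Data.Product using (_×_; Σ-syntax; ∃; ∃₂; ∃-syntax; _,_; proj₁; proj₂)
open import Data.Nat as ℕ using (ℕ; zero; suc; _+_; _∸_; _<_; _≤_; _⊓_; z≤n; s≤s)
open import Data.Nat.Properties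
open import Data.List
  using (List; []; _∷_; _++_; [_]; map; length; concat; intercalate; filter; deduplicate
        ; take; drop; applyUpTo)
open import Data.List.Properties
  using ( ++-assoc; ++-identityʳ; ++-cancelˡ; ∷-injective; map-++; map-∘; map-cong-local; length-++; length-map; concat-++
        ; filter-accept; filter-reject; length-applyUpTo; length-take; length-drop)
open import Data.List.Membership.Propositional using (_∈_)
open import Data.List.Membership.DecPropositional ℕ._≟_ using (_∈?_)
open import Data.List.Membership.Propositional.Properties
  using ( ∈-map⁺; ∈-map⁻; ∈-++⁺ˡ; ∈-++⁺ʳ; ∈-++⁻; ∈-concat⁺′; ∈-deduplicate⁺
        ; ∈-applyUpTo⁺; ∈-applyUpTo⁻)
open import Data.List.Relation.Unary.Any using (here; there)
open import Data.List.Relation.Unary.All as All using (All; []; _∷_)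
open import Data.List.Relation.Unary.Linked using (Linked; []; [-]; _∷_)
open import Data.List.Relation.Unary.Linked.Properties using (applyUpTo⁺₁)
open import Data.List.Relation.Unary.All.Properties as All using ()
open import Data.Bool using (true; false; if_then_else_)
open import Relation.Nullary.Reflects using (ofʸ; ofⁿ)
open import Relation.Nullary using (¬_; Dec; does; yes; no; contradiction)
open import Relation.Nullary.Decidable as Dec using (toSum; _×-dec_; _⊎-dec_)
open import Relation.Binary.Definitions using (tri<; tri≈; tri>)
open import Relation.Binary.PropositionalEquality
  using (_≡_; _≢_; refl; sym; trans; cong; cong₂; subst; subst₂; module ≡-Reasoning)

-- Words, their maxima and their segments

≤-maxL : ∀ {x xs} → x ∈ xs → x ≤ maxL xs
≤-maxL {xs = y ∷ ys} (here refl) = m≤m⊔n y (maxL ys)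
≤-maxL {xs = y ∷ ys} (there p)   = ≤-trans (≤-maxL p) (m≤n⊔m y (maxL ys))

maxL-∈ : ∀ x xs → maxL (x ∷ xs) ∈ x ∷ xs
maxL-∈ x []       rewrite ⊔-identityʳ x = here refl
maxL-∈ x (y ∷ ys) with ⊔-sel x (maxL (y ∷ ys))
... | inj₁ eq rewrite eq = here refl
... | inj₂ eq rewrite eq = there (maxL-∈ y ys)

maxL≤ : ∀ {m xs} → All (_≤ m) xs → maxL xs ≤ m
maxL≤ []         = z≤n
maxL≤ (p ∷ ps)   = ⊔-lub p (maxL≤ ps)

<-suc-maxL : ∀ xs → All (_< suc (maxL xs)) xs
<-suc-maxL xs = All.tabulate (s≤s ∘ ≤-maxL)

StrictlyMonotoneOn : List ℕ → (ℕ → ℕ) → Set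
StrictlyMonotoneOn xs g = ∀ {x y} → x ∈ xs → y ∈ xs → x < y → g x < g y

module _ {xs : List ℕ} {g : ℕ → ℕ} (mono : StrictlyMonotoneOn xs g) where

  strictMonoOn⇒injOn : ∀ {x y} → x ∈ xs → y ∈ xs → g x ≡ g y → x ≡ y
  strictMonoOn⇒injOn {x} {y} x∈ y∈ eq with <-cmp x y
  ... | tri< x<y _ _ = contradiction eq (<⇒≢ (mono x∈ y∈ x<y))
  ... | tri≈ _ x≡y _ = x≡y
  ... | tri> _ _ y<x = contradiction (sym eq) (<⇒≢ (mono y∈ x∈ y<x))

  strictMonoOn⇒monoOn : ∀ {x y} → x ∈ xs → y ∈ xs → x ≤ y → g x ≤ g y
  strictMonoOn⇒monoOn x∈ y∈ x≤y with m≤n⇒m<n∨m≡n x≤y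
  ... | inj₁ x<y  = <⇒≤ (mono x∈ y∈ x<y)
  ... | inj₂ refl = ≤-refl

strictMonoOn-⊆ : ∀ {xs ys g} → (∀ {x} → x ∈ ys → x ∈ xs) →
                 StrictlyMonotoneOn xs g → StrictlyMonotoneOn ys g
strictMonoOn-⊆ ys⊆xs mono x∈ y∈ = mono (ys⊆xs x∈) (ys⊆xs y∈)

maxL-map : ∀ {g} x xs → StrictlyMonotoneOn (x ∷ xs) g →
           maxL (map g (x ∷ xs)) ≡ g (maxL (x ∷ xs))
maxL-map {g} x xs mono = ≤-antisym
  (maxL≤ (All.tabulate λ p → bound (∈-map⁻ g p)))
  (≤-maxL (∈-map⁺ g (maxL-∈ x xs)))
  where
  bound : ∀ {y} → ∃ (λ x′ → x′ ∈ x ∷ xs × y ≡ g x′) → y ≤ g (maxL (x ∷ xs))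
  bound (x′ , x′∈ , refl) = strictMonoOn⇒monoOn mono x′∈ (maxL-∈ x xs) (≤-maxL x′∈)

module _ {A : Set} where

  intercalate-∷-++ : ∀ (ms x : List A) S y S′ →
    intercalate ms (x ∷ S ++ y ∷ S′) ≡ x ++ ms ++ intercalate ms (S ++ y ∷ S′)
  intercalate-∷-++ ms x []      y S′ = refl
  intercalate-∷-++ ms x (_ ∷ _) y S′ = refl

  intercalate-++ : ∀ (ms : List A) S s s′ S′ →
    intercalate ms (S ++ [ s ]) ++ intercalate ms (s′ ∷ S′) ≡
    intercalate ms (S ++ (s ++ s′) ∷ S′)
  intercalate-++ ms []      s s′ []        = refl
  intercalate-++ ms []      s s′ (s″ ∷ S′) = sym (++-assoc s s′ _)
  intercalate-++ ms (x ∷ S) s s′ S′ = begin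
    intercalate ms (x ∷ S ++ [ s ]) ++ intercalate ms (s′ ∷ S′)
      ≡⟨ cong (_++ intercalate ms (s′ ∷ S′)) (intercalate-∷-++ ms x S s []) ⟩
    (x ++ ms ++ intercalate ms (S ++ [ s ])) ++ intercalate ms (s′ ∷ S′)
      ≡⟨ ++-assoc x _ _ ⟩
    x ++ (ms ++ intercalate ms (S ++ [ s ])) ++ intercalate ms (s′ ∷ S′)
      ≡⟨ cong (x ++_) (++-assoc ms _ _) ⟩
    x ++ ms ++ intercalate ms (S ++ [ s ]) ++ intercalate ms (s′ ∷ S′)
      ≡⟨ cong (λ r → x ++ ms ++ r) (intercalate-++ ms S s s′ S′) ⟩
    x ++ ms ++ intercalate ms (S ++ (s ++ s′) ∷ S′)
      ≡⟨ sym (intercalate-∷-++ ms x S (s ++ s′) S′) ⟩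
    intercalate ms (x ∷ S ++ (s ++ s′) ∷ S′) ∎
    where open ≡-Reasoning

  concat-merge : ∀ (S : List (List A)) s s′ S′ →
    concat (S ++ [ s ]) ++ concat (s′ ∷ S′) ≡ concat (S ++ (s ++ s′) ∷ S′)
  concat-merge []      s s′ S′ = trans (cong (_++ _) (++-identityʳ s)) (sym (++-assoc s s′ _))
  concat-merge (x ∷ S) s s′ S′ = trans (++-assoc x _ _) (cong (x ++_) (concat-merge S s s′ S′))

  ∈-intercalate : ∀ {m : A} {ms} S → 1 < length S → m ∈ ms → m ∈ intercalate ms S
  ∈-intercalate (_ ∷ []) (s≤s ()) _
  ∈-intercalate (s ∷ s′ ∷ S) _ m∈ms = ∈-++⁺ʳ s (∈-++⁺ˡ m∈ms)

  All-intercalate : ∀ {P : A → Set} {ms} S → All P ms → All P (concat S) →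
                    All P (intercalate ms S)
  All-intercalate []           _   _  = []
  All-intercalate (s ∷ [])     _   ps = All.++⁻ˡ s ps
  All-intercalate (s ∷ s′ ∷ S) pms ps =
    All.++⁺ (All.++⁻ˡ s ps) (All.++⁺ pms (All-intercalate (s′ ∷ S) pms (All.++⁻ʳ s ps)))

  length-∈-intercalate-≤ : ∀ {ms s : List A} S → s ∈ S → length s ≤ length (intercalate ms S)
  length-∈-intercalate-≤ (s ∷ [])     (here refl) = ≤-refl
  length-∈-intercalate-≤ (s ∷ s′ ∷ S) (here refl) =
    ≤-trans (m≤m+n (length s) _) (≤-reflexive (sym (length-++ s)))
  length-∈-intercalate-≤ {ms} {s₁} (s ∷ s′ ∷ S) (there p) = begin
    length s₁                                  ≤⟨ length-∈-intercalate-≤ (s′ ∷ S) p ⟩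
    length (intercalate ms (s′ ∷ S))           ≤⟨ m≤n+m _ (length ms) ⟩
    length ms + length (intercalate ms (s′ ∷ S)) ≡⟨ sym (length-++ ms) ⟩
    length (ms ++ intercalate ms (s′ ∷ S))     ≤⟨ m≤n+m _ (length s) ⟩
    length s + length (ms ++ intercalate ms (s′ ∷ S)) ≡⟨ sym (length-++ s) ⟩
    length (intercalate ms (s ∷ s′ ∷ S))       ∎
    where open ≤-Reasoning

  length-∈-intercalate : ∀ {m : A} {s} S → 1 < length S → s ∈ S →
                         length s < length (intercalate [ m ] S)
  length-∈-intercalate (_ ∷ []) (s≤s ()) _
  length-∈-intercalate {m} {s} (s₀ ∷ s′ ∷ S) _ p = begin-strict
    length s                                   ≤⟨ bound p ⟩
    length s₀ + length (intercalate [ m ] (s′ ∷ S)) <⟨ +-monoʳ-< (length s₀) (n<1+n _) ⟩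
    length s₀ + suc (length (intercalate [ m ] (s′ ∷ S)))
      ≡⟨ sym (length-++ s₀ {m ∷ intercalate [ m ] (s′ ∷ S)}) ⟩
    length (intercalate [ m ] (s₀ ∷ s′ ∷ S))    ∎
    where
    open ≤-Reasoning
    bound : s ∈ s₀ ∷ s′ ∷ S → length s ≤ length s₀ + length (intercalate [ m ] (s′ ∷ S))
    bound (here refl) = m≤m+n _ _
    bound (there p)   = ≤-trans (length-∈-intercalate-≤ (s′ ∷ S) p) (m≤n+m _ _)

infixr 5 _◂_
_◂_ : ℕ → List (List ℕ) → List (List ℕ)
x ◂ []      = [ x ∷ [] ]
x ◂ (s ∷ S) = (x ∷ s) ∷ S

splitOn-≡ : ∀ m xs → splitOn m (m ∷ xs) ≡ [] ∷ splitOn m xs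
splitOn-≡ m xs with m ℕ.≟ m
... | yes _   = refl
... | no m≢m = contradiction refl m≢m

splitOn-≢ : ∀ {m x} xs → x ≢ m → splitOn m (x ∷ xs) ≡ x ◂ splitOn m xs
splitOn-≢ {m} {x} xs x≢m with x ℕ.≟ m | splitOn m xs
... | yes x≡m | _     = contradiction x≡m x≢m
... | no _    | []    = refl
... | no _    | _ ∷ _ = refl

splitOn-∷ : ∀ m xs → ∃₂ λ s S → splitOn m xs ≡ s ∷ S
splitOn-∷ m []       = [] , [] , refl
splitOn-∷ m (x ∷ xs) with toSum (x ℕ.≟ m)
... | inj₁ refl = [] , splitOn m xs , splitOn-≡ m xs
... | inj₂ x≢m with splitOn-∷ m xs
...   | s , S , eq = x ∷ s , S , trans (splitOn-≢ xs x≢m) (cong (x ◂_) eq)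

intercalate-◂ : ∀ m x S → intercalate [ m ] (x ◂ S) ≡ x ∷ intercalate [ m ] S
intercalate-◂ m x []           = refl
intercalate-◂ m x (s ∷ [])     = refl
intercalate-◂ m x (s ∷ s′ ∷ S) = refl

concat-◂ : ∀ x S → concat (x ◂ S) ≡ x ∷ concat S
concat-◂ x []      = refl
concat-◂ x (s ∷ S) = refl

map-◂ : ∀ g x S → map (map g) (x ◂ S) ≡ g x ◂ map (map g) S
map-◂ g x []      = refl
map-◂ g x (s ∷ S) = refl

intercalate-splitOn : ∀ m xs → intercalate [ m ] (splitOn m xs) ≡ xs
intercalate-splitOn m [] = refl
intercalate-splitOn m (x ∷ xs) with toSum (x ℕ.≟ m)
... | inj₁ refl with splitOn-∷ m xs
...   | s , S , eq = begin
  intercalate [ m ] (splitOn m (m ∷ xs)) ≡⟨ cong (intercalate [ m ]) (splitOn-≡ m xs) ⟩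
  intercalate [ m ] ([] ∷ splitOn m xs)  ≡⟨ cong (intercalate [ m ] ∘ ([] ∷_)) eq ⟩
  m ∷ intercalate [ m ] (s ∷ S)          ≡⟨ cong (λ S′ → m ∷ intercalate [ m ] S′) (sym eq) ⟩
  m ∷ intercalate [ m ] (splitOn m xs)   ≡⟨ cong (m ∷_) (intercalate-splitOn m xs) ⟩
  m ∷ xs                                 ∎
  where open ≡-Reasoning
intercalate-splitOn m (x ∷ xs) | inj₂ x≢m = begin
  intercalate [ m ] (splitOn m (x ∷ xs)) ≡⟨ cong (intercalate [ m ]) (splitOn-≢ xs x≢m) ⟩
  intercalate [ m ] (x ◂ splitOn m xs)   ≡⟨ intercalate-◂ m x (splitOn m xs) ⟩
  x ∷ intercalate [ m ] (splitOn m xs)   ≡⟨ cong (x ∷_) (intercalate-splitOn m xs) ⟩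
  x ∷ xs                                 ∎
  where open ≡-Reasoning

concat-splitOn : ∀ m xs → All (λ y → y ∈ xs × y ≢ m) (concat (splitOn m xs))
concat-splitOn m [] = []
concat-splitOn m (x ∷ xs) with toSum (x ℕ.≟ m)
... | inj₁ refl rewrite splitOn-≡ x xs =
  All.map (λ (y∈ , y≢) → there y∈ , y≢) (concat-splitOn x xs)
... | inj₂ x≢m rewrite splitOn-≢ xs x≢m | concat-◂ x (splitOn m xs) =
  (here refl , x≢m) ∷ All.map (λ (y∈ , y≢) → there y∈ , y≢) (concat-splitOn m xs)

splitOn-intercalate : ∀ m s S → All (_≢ m) (concat (s ∷ S)) →
                      splitOn m (intercalate [ m ] (s ∷ S)) ≡ s ∷ S
splitOn-intercalate m []      []       _  = refl
splitOn-intercalate m []      (s ∷ S)  ps =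
  trans (splitOn-≡ m (intercalate [ m ] (s ∷ S))) (cong ([] ∷_) (splitOn-intercalate m s S ps))
splitOn-intercalate m (x ∷ s) S (x≢m ∷ ps) = begin
  splitOn m (intercalate [ m ] ((x ∷ s) ∷ S)) ≡⟨ cong (splitOn m) (intercalate-◂ m x (s ∷ S)) ⟩
  splitOn m (x ∷ intercalate [ m ] (s ∷ S))   ≡⟨ splitOn-≢ (intercalate [ m ] (s ∷ S)) x≢m ⟩
  x ◂ splitOn m (intercalate [ m ] (s ∷ S))   ≡⟨ cong (x ◂_) (splitOn-intercalate m s S ps) ⟩
  (x ∷ s) ∷ S                                 ∎
  where open ≡-Reasoning

splitOn-map : ∀ g m xs → (∀ {y} → y ∈ xs → g y ≡ g m → y ≡ m) →
              splitOn (g m) (map g xs) ≡ map (map g) (splitOn m xs)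
splitOn-map g m []       _   = refl
splitOn-map g m (x ∷ xs) inj with toSum (x ℕ.≟ m)
... | inj₁ refl = begin
  splitOn (g m) (g m ∷ map g xs)       ≡⟨ splitOn-≡ (g m) (map g xs) ⟩
  [] ∷ splitOn (g m) (map g xs)        ≡⟨ cong ([] ∷_) (splitOn-map g m xs (inj ∘ there)) ⟩
  [] ∷ map (map g) (splitOn m xs)      ≡⟨ cong (map (map g)) (sym (splitOn-≡ m xs)) ⟩
  map (map g) (splitOn m (m ∷ xs))     ∎
  where open ≡-Reasoning
... | inj₂ x≢m = begin
  splitOn (g m) (g x ∷ map g xs)       ≡⟨ splitOn-≢ (map g xs) (x≢m ∘ inj (here refl)) ⟩
  g x ◂ splitOn (g m) (map g xs)       ≡⟨ cong (g x ◂_) (splitOn-map g m xs (inj ∘ there)) ⟩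
  g x ◂ map (map g) (splitOn m xs)     ≡⟨ sym (map-◂ g x (splitOn m xs)) ⟩
  map (map g) (x ◂ splitOn m xs)       ≡⟨ cong (map (map g)) (sym (splitOn-≢ xs x≢m)) ⟩
  map (map g) (splitOn m (x ∷ xs))     ∎
  where open ≡-Reasoning

∈-splitOn : ∀ {m xs s y} → s ∈ splitOn m xs → y ∈ s → y ∈ xs
∈-splitOn {m} {xs} s∈ y∈ = proj₁ (All.lookup (concat-splitOn m xs) (∈-concat⁺′ y∈ s∈))

1<length-splitOn : ∀ {m xs} → m ∈ xs → 1 < length (splitOn m xs)
1<length-splitOn {m} {xs} m∈xs with splitOn-∷ m xs
... | s , _ ∷ _ , eq rewrite eq = s≤s (s≤s z≤n)
... | s , []    , eq = contradiction refl (proj₂ (All.lookup avoids m∈s))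
  where
  avoids : All (λ y → y ∈ xs × y ≢ m) (s ++ [])
  avoids = subst (All (λ y → y ∈ xs × y ≢ m) ∘ concat) eq (concat-splitOn m xs)
  m∈s : m ∈ s ++ []
  m∈s = subst (m ∈_) (sym (trans (++-identityʳ s)
          (trans (cong (intercalate [ m ]) (sym eq)) (intercalate-splitOn m xs)))) m∈xs

splitOn-maxL-below : ∀ xs → All (_< maxL xs) (concat (splitOn (maxL xs) xs))
splitOn-maxL-below xs =
  All.map (λ (y∈ , y≢) → ≤∧≢⇒< (≤-maxL y∈) y≢) (concat-splitOn (maxL xs) xs)

length-∈-splitOn-maxL : ∀ x xs {s} → s ∈ splitOn (maxL (x ∷ xs)) (x ∷ xs) → length s ≤ length xs
length-∈-splitOn-maxL x xs {s} s∈ = ≤-pred (subst (length s <_)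
  (cong length (intercalate-splitOn (maxL (x ∷ xs)) (x ∷ xs)))
  (length-∈-intercalate _ (1<length-splitOn (maxL-∈ x xs)) s∈))

-- The tree of a word

treeF : ℕ → List ℕ → Tree
treeF zero    _        = leaf
treeF (suc f) []       = leaf
treeF (suc f) (x ∷ xs) = mkNode (map (treeF f) (splitOn (maxL (x ∷ xs)) (x ∷ xs)))

tree : List ℕ → Tree
tree xs = treeF (length xs) xs

treeF-stable : ∀ f f′ xs → length xs ≤ f → length xs ≤ f′ → treeF f xs ≡ treeF f′ xs
treeF-stable zero    zero     _ _ _ = refl
treeF-stable zero    (suc f′) [] _ _ = refl
treeF-stable (suc f) zero     [] _ _ = refl
treeF-stable (suc f) (suc f′) [] _ _ = refl
treeF-stable (suc f) (suc f′) (x ∷ xs) (s≤s l≤f) (s≤s l≤f′) =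
  cong mkNode (map-cong-local (All.tabulate λ s∈ →
    let l = length-∈-splitOn-maxL x xs s∈ in treeF-stable f f′ _ (≤-trans l l≤f) (≤-trans l l≤f′)))

tree-unfold : ∀ xs → tree xs ≡ mkNode (map tree (splitOn (maxL xs) xs))
tree-unfold []       = refl
tree-unfold (x ∷ xs) = cong mkNode (map-cong-local (All.tabulate λ s∈ →
  treeF-stable _ _ _ (length-∈-splitOn-maxL x xs s∈) ≤-refl))

treeF-relabel : ∀ f {g} xs → StrictlyMonotoneOn xs g → treeF f (map g xs) ≡ treeF f xs
treeF-relabel zero    xs       _    = refl
treeF-relabel (suc f) []       _    = refl
treeF-relabel (suc f) {g} (x ∷ xs) mono = cong mkNode (begin
  map (treeF f) (splitOn (maxL (map g (x ∷ xs))) (map g (x ∷ xs)))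
    ≡⟨ cong (λ m → map (treeF f) (splitOn m (map g (x ∷ xs)))) (maxL-map x xs mono) ⟩
  map (treeF f) (splitOn (g M) (map g (x ∷ xs)))
    ≡⟨ cong (map (treeF f)) (splitOn-map g M (x ∷ xs) λ y∈ → strictMonoOn⇒injOn mono y∈ (maxL-∈ x xs)) ⟩
  map (treeF f) (map (map g) (splitOn M (x ∷ xs)))
    ≡⟨ sym (map-∘ (splitOn M (x ∷ xs))) ⟩
  map (treeF f ∘ map g) (splitOn M (x ∷ xs))
    ≡⟨ map-cong-local (All.tabulate λ s∈ → treeF-relabel f _ (strictMonoOn-⊆ (∈-splitOn s∈) mono)) ⟩
  map (treeF f) (splitOn M (x ∷ xs)) ∎)
  where
  M = maxL (x ∷ xs)
  open ≡-Reasoning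

tree-relabel : ∀ {g} xs → StrictlyMonotoneOn xs g → tree (map g xs) ≡ tree xs
tree-relabel {g} xs mono =
  trans (cong (λ f → treeF f (map g xs)) (length-map g xs)) (treeF-relabel (length xs) xs mono)

countAtMost : List ℕ → ℕ → ℕ
countAtMost D v = length (filter (_≤? v) D)

countAtMost-accept : ∀ {d v} D → d ≤ v → countAtMost (d ∷ D) v ≡ suc (countAtMost D v)
countAtMost-accept {v = v} D d≤v = cong length (filter-accept (_≤? v) {xs = D} d≤v)

countAtMost-reject : ∀ {d v} D → ¬ d ≤ v → countAtMost (d ∷ D) v ≡ countAtMost D v
countAtMost-reject {v = v} D d≰v = cong length (filter-reject (_≤? v) {xs = D} d≰v)

countAtMost-mono : ∀ D {x y} → x ≤ y → countAtMost D x ≤ countAtMost D y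
countAtMost-mono []      _ = z≤n
countAtMost-mono (d ∷ D) {x} {y} x≤y with d ≤? x | d ≤? y
... | yes d≤x | yes d≤y rewrite countAtMost-accept D d≤x | countAtMost-accept D d≤y = s≤s (countAtMost-mono D x≤y)
... | yes d≤x | no d≰y  = contradiction (≤-trans d≤x x≤y) d≰y
... | no d≰x  | yes d≤y rewrite countAtMost-reject D d≰x | countAtMost-accept D d≤y =
  m≤n⇒m≤1+n (countAtMost-mono D x≤y)
... | no d≰x  | no d≰y  rewrite countAtMost-reject D d≰x | countAtMost-reject D d≰y = countAtMost-mono D x≤y

countAtMost-strict : ∀ D {x y} → y ∈ D → x < y → countAtMost D x < countAtMost D y
countAtMost-strict (d ∷ D) {x} {y} y∈ x<y with d ≤? x | d ≤? y | y∈
... | yes d≤x | _       | here refl = contradiction d≤x (<⇒≱ x<y)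
... | _       | no d≰y  | here refl = contradiction ≤-refl d≰y
... | no d≰x  | yes d≤y | here refl rewrite countAtMost-reject D d≰x | countAtMost-accept D d≤y =
  s≤s (countAtMost-mono D (<⇒≤ x<y))
... | yes d≤x | no d≰y  | there _   = contradiction (≤-trans d≤x (<⇒≤ x<y)) d≰y
... | yes d≤x | yes d≤y | there y∈D rewrite countAtMost-accept D d≤x | countAtMost-accept D d≤y =
  s≤s (countAtMost-strict D y∈D x<y)
... | no d≰x  | yes d≤y | there y∈D rewrite countAtMost-reject D d≰x | countAtMost-accept D d≤y =
  m≤n⇒m≤1+n (countAtMost-strict D y∈D x<y)
... | no d≰x  | no d≰y  | there y∈D rewrite countAtMost-reject D d≰x | countAtMost-reject D d≰y =
  countAtMost-strict D y∈D x<y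

standardize-strictMonoOn : ∀ xs → StrictlyMonotoneOn xs (countAtMost (deduplicate ℕ._≟_ xs))
standardize-strictMonoOn xs _ y∈ = countAtMost-strict _ (∈-deduplicate⁺ ℕ._≟_ y∈)

Γf≡treeF : ∀ f xs → Γf f xs ≡ treeF f xs
Γf≡treeF zero    _        = refl
Γf≡treeF (suc f) []       = refl
Γf≡treeF (suc f) (x ∷ xs) = cong mkNode (map-cong-local (All.tabulate λ {s} _ →
  trans (Γf≡treeF f (standardize s)) (treeF-relabel f s (standardize-strictMonoOn s))))

Γ≡tree : ∀ xs → Γ xs ≡ tree xs
Γ≡tree xs = Γf≡treeF (length xs) xs

children : Tree → List Tree
children leaf       = []
children (⋁ a b cs) = a ∷ b ∷ cs

children-injective : ∀ {w w′} → children w ≡ children w′ → w ≡ w′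
children-injective {leaf}      {leaf}      _    = refl
children-injective {⋁ _ _ _} {⋁ _ _ _} refl = refl

children-mkNode : ∀ ts → 1 < length ts → children (mkNode ts) ≡ ts
children-mkNode (a ∷ b ∷ cs) _ = refl
children-mkNode (_ ∷ []) (s≤s ())

1<length-∷-++-∷ : ∀ {A : Set} (x : A) xs y ys → 1 < length (x ∷ xs ++ y ∷ ys)
1<length-∷-++-∷ x []      y ys = s≤s (s≤s z≤n)
1<length-∷-++-∷ x (_ ∷ _) y ys = s≤s (s≤s z≤n)

maxL<suc : ∀ {n xs} → All (_< suc n) xs → maxL xs < suc n
maxL<suc xs<n = s≤s (maxL≤ (All.map ≤-pred xs<n))

maxL-intercalate : ∀ m S → 1 < length S → All (_< m) (concat S) →
                   maxL (intercalate [ m ] S) ≡ m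
maxL-intercalate m S 1<∣S∣ S<m = ≤-antisym
  (maxL≤ (All-intercalate S (≤-refl ∷ []) (All.map <⇒≤ S<m)))
  (≤-maxL (∈-intercalate S 1<∣S∣ (here refl)))

children-tree-intercalate : ∀ m S → 1 < length S → All (_< m) (concat S) →
                            children (tree (intercalate [ m ] S)) ≡ map tree S
children-tree-intercalate m (s ∷ S) 1<∣S∣ S<m = begin
  children (tree xs)                                    ≡⟨ cong children (tree-unfold xs) ⟩
  children (mkNode (map tree (splitOn (maxL xs) xs)))   ≡⟨ cong (λ k → children (mkNode (map tree (splitOn k xs))))
                                                             (maxL-intercalate m (s ∷ S) 1<∣S∣ S<m) ⟩
  children (mkNode (map tree (splitOn m xs)))           ≡⟨ cong (children ∘ mkNode ∘ map tree)
                                                             (splitOn-intercalate m s S (All.map <⇒≢ S<m)) ⟩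
  children (mkNode (map tree (s ∷ S)))                  ≡⟨ children-mkNode (map tree (s ∷ S))
                                                             (subst (1 <_) (sym (length-map tree (s ∷ S))) 1<∣S∣) ⟩
  map tree (s ∷ S)                                      ∎
  where
  xs = intercalate [ m ] (s ∷ S)
  open ≡-Reasoning

children-tree-intercalate-++ : ∀ m S s s′ S′ → 1 < length (S ++ (s ++ s′) ∷ S′) →
  All (_< m) (concat (S ++ [ s ])) → All (_< m) (concat (s′ ∷ S′)) →
  children (tree (intercalate [ m ] (S ++ [ s ]) ++ intercalate [ m ] (s′ ∷ S′))) ≡
  map tree (S ++ (s ++ s′) ∷ S′)
children-tree-intercalate-++ m S s s′ S′ 1<∣S∣ S<m S′<m =
  trans (cong (children ∘ tree) (intercalate-++ [ m ] S s s′ S′))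
        (children-tree-intercalate m _ 1<∣S∣
          (subst (All (_< m)) (concat-merge S s s′ S′) (All.++⁺ S<m S′<m)))

maxL-segments : ∀ x xs → let M = maxL (x ∷ xs) in
  ∃[ S ] (intercalate [ M ] S ≡ x ∷ xs × All (_< M) (concat S) × 1 < length S
          × map tree S ≡ children (tree (x ∷ xs)))
maxL-segments x xs = S , intercalate-splitOn M (x ∷ xs) , S<M , 1<∣S∣ , sym (begin
  children (tree (x ∷ xs))                    ≡⟨ cong (children ∘ tree) (sym (intercalate-splitOn M (x ∷ xs))) ⟩
  children (tree (intercalate [ M ] S))       ≡⟨ children-tree-intercalate M S 1<∣S∣ S<M ⟩
  map tree S                                  ∎)
  where
  M = maxL (x ∷ xs)
  S = splitOn M (x ∷ xs)
  S<M : All (_< M) (concat S)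
  S<M = splitOn-maxL-below (x ∷ xs)
  1<∣S∣ : 1 < length S
  1<∣S∣ = 1<length-splitOn (maxL-∈ x xs)
  open ≡-Reasoning

tree≡leaf⇒[] : ∀ {xs} → tree xs ≡ leaf → xs ≡ []
tree≡leaf⇒[] {[]}     _  = refl
tree≡leaf⇒[] {x ∷ xs} eq with maxL-segments x xs
... | []    , () , _
... | _ ∷ _ , _  , _ , _ , eqS with trans eqS (cong children eq)
...   | ()

above : List (List ℕ) → ℕ
above S = suc (maxL (concat S))

word  : Tree → List ℕ
words : List Tree → List (List ℕ)
word leaf       = []
word (⋁ a b cs) = intercalate [ above (word a ∷ word b ∷ words cs) ] (word a ∷ word b ∷ words cs)
words []       = []
words (c ∷ cs) = word c ∷ words cs

tree-word : ∀ t → tree (word t) ≡ t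
map-tree-words : ∀ ts → map tree (words ts) ≡ ts
tree-word leaf       = refl
tree-word (⋁ a b cs) = children-injective (trans
  (children-tree-intercalate _ (word a ∷ word b ∷ words cs) (s≤s (s≤s z≤n)) (<-suc-maxL _))
  (cong₂ _∷_ (tree-word a) (cong₂ _∷_ (tree-word b) (map-tree-words cs))))
map-tree-words []       = refl
map-tree-words (c ∷ cs) = cong₂ _∷_ (tree-word c) (map-tree-words cs)

map-tree-words-++ : ∀ T s Z → map tree (words T ++ s ∷ words Z) ≡ T ++ tree s ∷ Z
map-tree-words-++ T s Z = trans (map-++ tree (words T) (s ∷ words Z))
  (cong₂ _++_ (map-tree-words T) (cong (tree s ∷_) (map-tree-words Z)))

-- The three products, computed on words

Concat : Op → Tree → Tree → Tree → Set
Concat op t z w = Σ[ u ∈ List ℕ ] Σ[ v ∈ List ℕ ]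
  (tree u ≡ t × tree v ≡ z × Cmp op (maxL u) (maxL v) × tree (u ++ v) ≡ w)

AnyConcat : Tree → Tree → Tree → Set
AnyConcat t z w = Σ[ u ∈ List ℕ ] Σ[ v ∈ List ℕ ] (tree u ≡ t × tree v ≡ z × tree (u ++ v) ≡ w)

Framed : List Tree → List Tree → (Tree → Set) → List Tree → Set
Framed T Z Q ws = Σ[ y ∈ Tree ] (ws ≡ T ++ y ∷ Z × Q y)

map≡∷ʳ⁻ : ∀ {A B : Set} (f : A → B) xs ys y → map f xs ≡ ys ++ [ y ] →
          ∃₂ λ xs′ x → xs ≡ xs′ ++ [ x ] × map f xs′ ≡ ys × f x ≡ y
map≡∷ʳ⁻ f (x ∷ [])     []       y refl = [] , x , refl , refl , refl
map≡∷ʳ⁻ f (x ∷ xs)     (y′ ∷ ys) y eq with ∷-injective eq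
... | refl , eq′ with map≡∷ʳ⁻ f xs ys y eq′
...   | xs′ , x′ , refl , refl , refl = x ∷ xs′ , x′ , refl , refl , refl

firstSegment : ∀ {x xs z₀ z₁ zs} → tree (x ∷ xs) ≡ ⋁ z₀ z₁ zs → let M = maxL (x ∷ xs) in
  ∃₂ λ s S → intercalate [ M ] (s ∷ S) ≡ x ∷ xs × All (_< M) (concat (s ∷ S))
           × tree s ≡ z₀ × map tree S ≡ z₁ ∷ zs
firstSegment {x} {xs} tv with maxL-segments x xs
... | []    , _ , _ , _ , eqS = contradiction (trans eqS (cong children tv)) λ ()
... | s ∷ S , v≡ , S<M , _ , eqS with ∷-injective (trans eqS (cong children tv))
...   | ts≡z₀ , eqS′ = s , S , v≡ , S<M , ts≡z₀ , eqS′

lastSegment : ∀ {x xs t t₀ tm tk} → tree (x ∷ xs) ≡ t → children t ≡ t₀ ∷ tm ++ [ tk ] →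
  let M = maxL (x ∷ xs) in
  ∃₂ λ S s → intercalate [ M ] (S ++ [ s ]) ≡ x ∷ xs × All (_< M) (concat (S ++ [ s ]))
           × map tree S ≡ t₀ ∷ tm × tree s ≡ tk
lastSegment {x} {xs} {t} {t₀} {tm} {tk} tu ch-t with maxL-segments x xs
... | S , u≡ , S<M , _ , eqS
  with map≡∷ʳ⁻ tree S (t₀ ∷ tm) tk (trans eqS (trans (cong children tu) ch-t))
...   | S′ , s , refl , eqS′ , ts≡tk = S′ , s , u≡ , S<M , eqS′ , ts≡tk

module Glue (T : List Tree) (a b : List ℕ) (Z : List Tree) where

  M : ℕ
  M = above (words T ++ a ∷ b ∷ words Z)

  left right : List ℕ
  left  = intercalate [ M ] (words T ++ [ a ])
  right = intercalate [ M ] (b ∷ words Z)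

  private
    segments<M : All (All (_< M)) (words T ++ a ∷ b ∷ words Z)
    segments<M = All.concat⁻ (<-suc-maxL (concat (words T ++ a ∷ b ∷ words Z)))

    a<M : All (_< M) a
    a<M = All.head (All.++⁻ʳ (words T) segments<M)

    b<M : All (_< M) b
    b<M = All.head (All.tail (All.++⁻ʳ (words T) segments<M))

    left<M : All (_< M) (concat (words T ++ [ a ]))
    left<M = All.concat⁺ (All.++⁺ (All.++⁻ˡ (words T) segments<M) (a<M ∷ []))

    right<M : All (_< M) (concat (b ∷ words Z))
    right<M = All.concat⁺ (b<M ∷ All.tail (All.tail (All.++⁻ʳ (words T) segments<M)))

  maxL-a<M : maxL a < M
  maxL-a<M = maxL<suc a<M

  maxL-b<M : maxL b < M
  maxL-b<M = maxL<suc b<M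

  maxL-left : 1 < length (words T ++ [ a ]) → maxL left ≡ M
  maxL-left 1<∣S∣ = maxL-intercalate M (words T ++ [ a ]) 1<∣S∣ left<M

  maxL-right : 1 < length (b ∷ words Z) → maxL right ≡ M
  maxL-right 1<∣S∣ = maxL-intercalate M (b ∷ words Z) 1<∣S∣ right<M

  tree-left : ∀ {t tk} → 1 < length (words T ++ [ a ]) → tree a ≡ tk → children t ≡ T ++ [ tk ] → tree left ≡ t
  tree-left 1<∣S∣ refl ch-t = children-injective (begin
    children (tree left)                  ≡⟨ children-tree-intercalate M _ 1<∣S∣ left<M ⟩
    map tree (words T ++ a ∷ words [])    ≡⟨ map-tree-words-++ T a [] ⟩
    T ++ [ tree a ]                       ≡⟨ sym ch-t ⟩
    children _                            ∎)
    where open ≡-Reasoning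

  tree-right : ∀ {z z₀} → 1 < length (b ∷ words Z) → tree b ≡ z₀ → children z ≡ z₀ ∷ Z → tree right ≡ z
  tree-right 1<∣S∣ refl ch-z = children-injective (begin
    children (tree right)                 ≡⟨ children-tree-intercalate M _ 1<∣S∣ right<M ⟩
    map tree (words [] ++ b ∷ words Z)    ≡⟨ map-tree-words-++ [] b Z ⟩
    tree b ∷ Z                            ≡⟨ sym ch-z ⟩
    children _                            ∎)
    where open ≡-Reasoning

  tree-left-right : ∀ {w y} → 1 < length (words T ++ (a ++ b) ∷ words Z) →
                    tree (a ++ b) ≡ y → children w ≡ T ++ y ∷ Z → tree (left ++ right) ≡ w
  tree-left-right 1<∣S∣ refl ch-w = children-injective (begin
    children (tree (left ++ right))
      ≡⟨ children-tree-intercalate-++ M (words T) a b (words Z) 1<∣S∣ left<M right<M ⟩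
    map tree (words T ++ (a ++ b) ∷ words Z)
      ≡⟨ map-tree-words-++ T (a ++ b) Z ⟩
    T ++ tree (a ++ b) ∷ Z
      ≡⟨ sym ch-w ⟩
    children _ ∎)
    where open ≡-Reasoning

concat≻-shape : ∀ {t z₀ z₁ zs w} → Concat ≻op t (⋁ z₀ z₁ zs) w →
                Framed [] (z₁ ∷ zs) (AnyConcat t z₀) (children w)
concat≻-shape (u , [] , _ , () , _)
concat≻-shape {t} {z₀} {z₁} {zs} (u , x ∷ xs , tu , tv , u<v , refl) with firstSegment tv
... | s , [] , _ , _ , _ , ()
... | s , s₁ ∷ S , v≡ , S<M , ts≡z₀ , eqS = tree (u ++ s) , ch , u , s , tu , ts≡z₀ , refl
  where
  M = maxL (x ∷ xs)
  u<M : All (_< M) u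
  u<M = All.tabulate λ y∈u → ≤-<-trans (≤-maxL y∈u) u<v
  ch : children (tree (u ++ x ∷ xs)) ≡ tree (u ++ s) ∷ z₁ ∷ zs
  ch = begin
    children (tree (u ++ x ∷ xs))
      ≡⟨ cong (λ v → children (tree (u ++ v))) (sym v≡) ⟩
    children (tree (u ++ intercalate [ M ] (s ∷ s₁ ∷ S)))
      ≡⟨ children-tree-intercalate-++ M [] u s (s₁ ∷ S) (s≤s (s≤s z≤n)) (All.++⁺ u<M []) S<M ⟩
    tree (u ++ s) ∷ tree s₁ ∷ map tree S
      ≡⟨ cong (tree (u ++ s) ∷_) eqS ⟩
    tree (u ++ s) ∷ z₁ ∷ zs ∎
    where open ≡-Reasoning

concat·-shape : ∀ {t t₀ tm tk z₀ z₁ zs w} → children t ≡ t₀ ∷ tm ++ [ tk ] →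
                Concat ·op t (⋁ z₀ z₁ zs) w → Framed (t₀ ∷ tm) (z₁ ∷ zs) (AnyConcat tk z₀) (children w)
concat·-shape _    (_ , [] , _ , () , _)
concat·-shape ch-t ([] , _ , tu , _) = contradiction (trans (cong children tu) ch-t) λ ()
concat·-shape {t₀ = t₀} {tm} {tk} {z₀} {z₁} {zs} ch-t (x ∷ xs , y ∷ ys , tu , tv , Mu≡Mv , refl)
  with lastSegment {x} {xs} tu ch-t | firstSegment tv
... | [] , _ , _ , _ , () , _ | _
... | _ , _ , _ , _ , _ , _ | _ , [] , _ , _ , _ , ()
... | s₀ ∷ Su , uk , u≡ , Su<Mu , eqSu , tuk | s , s₁ ∷ Sv , v≡ , Sv<M , ts , eqSv =
  tree (uk ++ s) , ch , uk , s , tuk , ts , refl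
  where
  M = maxL (y ∷ ys)
  u≡′ : intercalate [ M ] ((s₀ ∷ Su) ++ [ uk ]) ≡ x ∷ xs
  u≡′ = subst (λ m → intercalate [ m ] ((s₀ ∷ Su) ++ [ uk ]) ≡ x ∷ xs) Mu≡Mv u≡
  ch : children (tree ((x ∷ xs) ++ y ∷ ys)) ≡ (t₀ ∷ tm) ++ tree (uk ++ s) ∷ z₁ ∷ zs
  ch = begin
    children (tree ((x ∷ xs) ++ y ∷ ys))
      ≡⟨ cong₂ (λ u v → children (tree (u ++ v))) (sym u≡′) (sym v≡) ⟩
    children (tree (intercalate [ M ] ((s₀ ∷ Su) ++ [ uk ]) ++ intercalate [ M ] (s ∷ s₁ ∷ Sv)))
      ≡⟨ children-tree-intercalate-++ M (s₀ ∷ Su) uk s (s₁ ∷ Sv) (1<length-∷-++-∷ s₀ Su _ _)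
           (subst (λ m → All (_< m) _) Mu≡Mv Su<Mu) Sv<M ⟩
    map tree ((s₀ ∷ Su) ++ (uk ++ s) ∷ s₁ ∷ Sv)
      ≡⟨ map-++ tree (s₀ ∷ Su) _ ⟩
    map tree (s₀ ∷ Su) ++ tree (uk ++ s) ∷ map tree (s₁ ∷ Sv)
      ≡⟨ cong₂ (λ T Z → T ++ tree (uk ++ s) ∷ Z) eqSu eqSv ⟩
    (t₀ ∷ tm) ++ tree (uk ++ s) ∷ z₁ ∷ zs ∎
    where open ≡-Reasoning

concat≺-shape : ∀ {t t₀ tm tk z w} → children t ≡ t₀ ∷ tm ++ [ tk ] →
                Concat ≺op t z w → Framed (t₀ ∷ tm) [] (AnyConcat tk z) (children w)
concat≺-shape ch-t ([] , _ , tu , _) = contradiction (trans (cong children tu) ch-t) λ ()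
concat≺-shape {t₀ = t₀} {tm} {tk} ch-t (x ∷ xs , v , tu , tv , v<u , refl) with lastSegment {x} {xs} tu ch-t
... | [] , _ , _ , _ , () , _
... | s₀ ∷ Su , uk , u≡ , Su<M , eqSu , tuk = tree (uk ++ v) , ch , uk , v , tuk , tv , refl
  where
  M = maxL (x ∷ xs)
  v<M : All (_< M) v
  v<M = All.tabulate λ y∈v → ≤-<-trans (≤-maxL y∈v) v<u
  ch : children (tree ((x ∷ xs) ++ v)) ≡ (t₀ ∷ tm) ++ [ tree (uk ++ v) ]
  ch = begin
    children (tree ((x ∷ xs) ++ v))
      ≡⟨ cong (λ u → children (tree (u ++ v))) (sym u≡) ⟩
    children (tree (intercalate [ M ] ((s₀ ∷ Su) ++ [ uk ]) ++ intercalate [ M ] [ v ]))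
      ≡⟨ children-tree-intercalate-++ M (s₀ ∷ Su) uk v [] (1<length-∷-++-∷ s₀ Su _ _) Su<M (All.++⁺ v<M []) ⟩
    map tree ((s₀ ∷ Su) ++ [ uk ++ v ])
      ≡⟨ map-++ tree (s₀ ∷ Su) _ ⟩
    map tree (s₀ ∷ Su) ++ [ tree (uk ++ v) ]
      ≡⟨ cong (_++ [ tree (uk ++ v) ]) eqSu ⟩
    (t₀ ∷ tm) ++ [ tree (uk ++ v) ] ∎
    where open ≡-Reasoning

framed-concat≻ : ∀ {t z₀ z₁ zs w} → Framed [] (z₁ ∷ zs) (AnyConcat t z₀) (children w) →
                 Concat ≻op t (⋁ z₀ z₁ zs) w
framed-concat≻ {z₁ = z₁} {zs} (_ , ch , u , v₀ , tu , tv₀ , tuv₀) =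
  u , right , tu , tree-right (1<∣S∣ v₀) tv₀ refl
  , subst (maxL u <_) (sym (maxL-right (1<∣S∣ v₀))) maxL-a<M , tree-left-right (1<∣S∣ (u ++ v₀)) tuv₀ ch
  where
  open Glue [] u v₀ (z₁ ∷ zs)
  1<∣S∣ : ∀ s → 1 < length (s ∷ words (z₁ ∷ zs))
  1<∣S∣ _ = s≤s (s≤s z≤n)

framed-concat· : ∀ {t t₀ tm tk z₀ z₁ zs w} → children t ≡ t₀ ∷ tm ++ [ tk ] →
                 Framed (t₀ ∷ tm) (z₁ ∷ zs) (AnyConcat tk z₀) (children w) → Concat ·op t (⋁ z₀ z₁ zs) w
framed-concat· {t₀ = t₀} {tm} {z₁ = z₁} {zs} ch-t (_ , ch , a , b , ta , tb , tab) =
  left , right , tree-left 1<∣S∣ ta ch-t , tree-right (s≤s (s≤s z≤n)) tb refl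
  , trans (maxL-left 1<∣S∣) (sym (maxL-right (s≤s (s≤s z≤n)))) , tree-left-right 1<∣S∣ tab ch
  where
  open Glue (t₀ ∷ tm) a b (z₁ ∷ zs)
  1<∣S∣ : ∀ {s S} → 1 < length (words (t₀ ∷ tm) ++ s ∷ S)
  1<∣S∣ = 1<length-∷-++-∷ (word t₀) (words tm) _ _

framed-concat≺ : ∀ {t t₀ tm tk z w} → children t ≡ t₀ ∷ tm ++ [ tk ] →
                 Framed (t₀ ∷ tm) [] (AnyConcat tk z) (children w) → Concat ≺op t z w
framed-concat≺ {t₀ = t₀} {tm} ch-t (_ , ch , a , v , ta , tv , tav) =
  left , v , tree-left 1<∣S∣ ta ch-t , tv
  , subst (maxL v <_) (sym (maxL-left 1<∣S∣)) maxL-b<M , tree-left-right 1<∣S∣ tav ch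
  where
  open Glue (t₀ ∷ tm) a v []
  1<∣S∣ : ∀ {s S} → 1 < length (words (t₀ ∷ tm) ++ s ∷ S)
  1<∣S∣ = 1<length-∷-++-∷ (word t₀) (words tm) _ _

concat≻⇔framed : ∀ {t z₀ z₁ zs w} →
  Concat ≻op t (⋁ z₀ z₁ zs) w ⇔ Framed [] (z₁ ∷ zs) (AnyConcat t z₀) (children w)
concat≻⇔framed = mk⇔ concat≻-shape framed-concat≻

concat·⇔framed : ∀ {t t₀ tm tk z₀ z₁ zs w} → children t ≡ t₀ ∷ tm ++ [ tk ] →
  Concat ·op t (⋁ z₀ z₁ zs) w ⇔ Framed (t₀ ∷ tm) (z₁ ∷ zs) (AnyConcat tk z₀) (children w)
concat·⇔framed ch-t = mk⇔ (concat·-shape ch-t) (framed-concat· ch-t)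

concat≺⇔framed : ∀ {t t₀ tm tk z w} → children t ≡ t₀ ∷ tm ++ [ tk ] →
  Concat ≺op t z w ⇔ Framed (t₀ ∷ tm) [] (AnyConcat tk z) (children w)
concat≺⇔framed ch-t = mk⇔ (concat≺-shape ch-t) (framed-concat≺ ch-t)

anyConcat⇔concat : ∀ {t z w} →
  AnyConcat t z w ⇔ ((Concat ≻op t z w ⊎ Concat ·op t z w) ⊎ Concat ≺op t z w)
anyConcat⇔concat = mk⇔ to from
  where
  to : ∀ {t z w} → AnyConcat t z w → (Concat ≻op t z w ⊎ Concat ·op t z w) ⊎ Concat ≺op t z w
  to (u , v , tu , tv , tuv) with <-cmp (maxL u) (maxL v)
  ... | tri< u<v _ _ = inj₁ (inj₁ (u , v , tu , tv , u<v , tuv))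
  ... | tri≈ _ u≡v _ = inj₁ (inj₂ (u , v , tu , tv , u≡v , tuv))
  ... | tri> _ _ v<u = inj₂ (u , v , tu , tv , v<u , tuv)
  from : ∀ {t z w} → (Concat ≻op t z w ⊎ Concat ·op t z w) ⊎ Concat ≺op t z w → AnyConcat t z w
  from (inj₁ (inj₁ (u , v , tu , tv , _ , tuv))) = u , v , tu , tv , tuv
  from (inj₁ (inj₂ (u , v , tu , tv , _ , tuv))) = u , v , tu , tv , tuv
  from (inj₂       (u , v , tu , tv , _ , tuv))  = u , v , tu , tv , tuv

anyConcat-leafˡ : ∀ {z w} → AnyConcat leaf z w ⇔ w ≡ z
anyConcat-leafˡ {z} = mk⇔
  (λ (u , v , tu , tv , tuv) → absorb-[]ˡ {u} {v} (tree≡leaf⇒[] {u} tu) tv tuv)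
  (λ w≡z → [] , word z , refl , tree-word z , trans (tree-word z) (sym w≡z))
  where
  absorb-[]ˡ : ∀ {u v w} → u ≡ [] → tree v ≡ z → tree (u ++ v) ≡ w → w ≡ z
  absorb-[]ˡ refl tv tuv = trans (sym tuv) tv

anyConcat-leafʳ : ∀ {t w} → AnyConcat t leaf w ⇔ w ≡ t
anyConcat-leafʳ {t} = mk⇔
  (λ (u , v , tu , tv , tuv) → absorb-[]ʳ {u} {v} (tree≡leaf⇒[] {v} tv) tu tuv)
  (λ w≡t → word t , [] , tree-word t , refl
          , trans (cong tree (++-identityʳ (word t))) (trans (tree-word t) (sym w≡t)))
  where
  absorb-[]ʳ : ∀ {u v w} → v ≡ [] → tree u ≡ t → tree (u ++ v) ≡ w → w ≡ t
  absorb-[]ʳ {u} refl tu tuv = trans (sym tuv) (trans (cong tree (++-identityʳ u)) tu)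

-- Shuffles

app-map : ∀ f xs {i} → i < length xs → app (map f xs) (suc i) ≡ f (app xs (suc i))
app-map f (x ∷ xs) {zero}  _         = refl
app-map f (x ∷ xs) {suc i} (s≤s i<n) = app-map f xs i<n

app-++ˡ : ∀ xs ys {i} → i < length xs → app (xs ++ ys) (suc i) ≡ app xs (suc i)
app-++ˡ (x ∷ xs) ys {zero}  _         = refl
app-++ˡ (x ∷ xs) ys {suc i} (s≤s i<n) = app-++ˡ xs ys i<n

app-++ʳ : ∀ xs ys i → app (xs ++ ys) (suc (length xs + i)) ≡ app ys (suc i)
app-++ʳ []       ys i = refl
app-++ʳ (x ∷ xs) ys i = app-++ʳ xs ys i

app-applyUpTo : ∀ f n {i} → i < n → app (applyUpTo f n) (suc i) ≡ f i
app-applyUpTo f (suc n) {zero}  _         = refl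
app-applyUpTo f (suc n) {suc i} (s≤s i<n) = app-applyUpTo (f ∘ suc) n i<n

app-take : ∀ k xs {x} → 0 < x → x ≤ k → app (take k xs) x ≡ app xs x
app-take zero    _        (s≤s _) ()
app-take (suc k) []       _ _ = refl
app-take (suc k) (x ∷ xs) {1}           _ _         = refl
app-take (suc k) (x ∷ xs) {suc (suc i)} _ (s≤s i<k) = app-take k xs (s≤s z≤n) i<k

app-drop : ∀ k xs {x} → 0 < x → app (drop k xs) x ≡ app xs (k + x)
app-drop zero    xs       _   = refl
app-drop (suc k) []       {suc _} _ = refl
app-drop (suc k) (y ∷ xs) {suc i} 0<x = begin
  app (drop k xs) (suc i)         ≡⟨ app-drop k xs 0<x ⟩
  app xs (k + suc i)              ≡⟨ cong (app xs) (+-suc k i) ⟩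
  app (y ∷ xs) (suc (suc (k + i))) ≡⟨ cong (app (y ∷ xs) ∘ suc) (sym (+-suc k i)) ⟩
  app (y ∷ xs) (suc (k + suc i))  ∎
  where open ≡-Reasoning

Linked-app : ∀ {xs} → Linked _<_ xs → ∀ {i j} → i < j → j < length xs →
             app xs (suc i) < app xs (suc j)
Linked-app (x<y ∷ _)  {zero}  {suc zero}    _         _           = x<y
Linked-app (x<y ∷ xs) {zero}  {suc (suc j)} _         (s≤s j<n)   =
  <-trans x<y (Linked-app xs {zero} {suc j} (s≤s z≤n) j<n)
Linked-app (_ ∷ xs)   {suc i} {suc j}       (s≤s i<j) (s≤s j<n)   = Linked-app xs i<j j<n
Linked-app [-]        {zero}  {suc j}       _         (s≤s ())

Linked-map : ∀ {f ys} → StrictlyMonotoneOn ys f → Linked _<_ ys → Linked _<_ (map f ys)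
Linked-map mono []          = []
Linked-map mono [-]         = [-]
Linked-map mono (x<y ∷ ys) =
  mono (here refl) (there (here refl)) x<y ∷ Linked-map (strictMonoOn-⊆ there mono) ys

countBelow : List ℕ → ℕ → ℕ
countBelow L zero    = 0
countBelow L (suc n) = if does (n ∈? L) then suc (countBelow L n) else countBelow L n

rank : List ℕ → ℕ → ℕ
rank L x = countBelow L (suc x)

countBelow-∈ : ∀ L {n} → n ∈ L → countBelow L (suc n) ≡ suc (countBelow L n)
countBelow-∈ L {n} n∈L with n ∈? L
... | yes _  = refl
... | no n∉L = contradiction n∈L n∉L

countBelow-∉ : ∀ L {n} → ¬ n ∈ L → countBelow L (suc n) ≡ countBelow L n
countBelow-∉ L {n} n∉L with n ∈? L
... | yes n∈L = contradiction n∈L n∉L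
... | no _    = refl

countBelow-≤-suc : ∀ L n → countBelow L n ≤ countBelow L (suc n)
countBelow-≤-suc L n with n ∈? L
... | yes _ = n≤1+n _
... | no _  = ≤-refl

countBelow-mono : ∀ L {m n} → m ≤ n → countBelow L m ≤ countBelow L n
countBelow-mono L {m} {zero}  z≤n = ≤-refl
countBelow-mono L {m} {suc n} m≤1+n with m≤n⇒m<n∨m≡n m≤1+n
... | inj₂ refl      = ≤-refl
... | inj₁ (s≤s m≤n) = ≤-trans (countBelow-mono L m≤n) (countBelow-≤-suc L n)

rank-mono : ∀ L {x y} → x ≤ y → rank L x ≤ rank L y
rank-mono L x≤y = countBelow-mono L (s≤s x≤y)

rank-pos : ∀ {L x} → x ∈ L → 0 < rank L x
rank-pos {L} x∈L rewrite countBelow-∈ L x∈L = s≤s z≤n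

rank-strictMonoOn : ∀ L → StrictlyMonotoneOn L (rank L)
rank-strictMonoOn L _ y∈L x<y rewrite countBelow-∈ L y∈L = s≤s (countBelow-mono L x<y)

select : List ℕ → ℕ → ℕ → ℕ
select L zero    j = zero
select L (suc n) j = if j ℕ.≤ᵇ countBelow L n then select L n j else n

select-spec : ∀ L n {j} → 0 < j → j ≤ countBelow L n → select L n j ∈ L × rank L (select L n j) ≡ j
select-spec L (suc n) {j} 0<j j≤c with j ℕ.≤ᵇ countBelow L n | ≤ᵇ-reflects-≤ j (countBelow L n)
... | true  | ofʸ j≤cₙ = select-spec L n 0<j j≤cₙ
... | false | ofⁿ j≰cₙ with toSum (n ∈? L)
...   | inj₁ n∈L = n∈L , ≤-antisym (≤-trans (≤-reflexive (countBelow-∈ L n∈L)) (≰⇒> j≰cₙ)) j≤c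
...   | inj₂ n∉L = contradiction (≤-trans j≤c (≤-reflexive (countBelow-∉ L n∉L))) j≰cₙ
select-spec L zero 0<j j≤0 = contradiction (≤-trans 0<j j≤0) λ ()

select-rank : ∀ {L x} → x ∈ L → select L (suc (maxL L)) (rank L x) ≡ x
select-rank {L} {x} x∈L =
  let (s∈L , rank-s) = select-spec L (suc (maxL L)) (rank-pos x∈L) (rank-mono L (≤-maxL x∈L))
  in strictMonoOn⇒injOn (rank-strictMonoOn L) s∈L x∈L rank-s

rank-<⇒< : ∀ L {x y} → rank L x < rank L y → x < y
rank-<⇒< L {x} {y} rx<ry = ≰⇒> λ y≤x → <⇒≱ rx<ry (rank-mono L y≤x)

sortedLetters : List ℕ → List ℕ
sortedLetters L = applyUpTo (select L (suc (maxL L)) ∘ suc) (rank L (maxL L))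

length-sortedLetters : ∀ L → length (sortedLetters L) ≡ rank L (maxL L)
length-sortedLetters L = length-applyUpTo _ _

module _ {L : List ℕ} where

  private
    N = suc (maxL L)

  app-sortedLetters : ∀ {j} → 0 < j → j ≤ rank L (maxL L) → app (sortedLetters L) j ≡ select L N j
  app-sortedLetters {suc i} _ i<r = app-applyUpTo _ _ i<r

  ∈-sortedLetters⁺ : ∀ {x} → x ∈ L → x ∈ sortedLetters L
  ∈-sortedLetters⁺ {x} x∈L with rank L x | rank-pos x∈L | rank-mono L (≤-maxL x∈L) | select-rank x∈L
  ... | suc i | _ | i<r | refl = ∈-applyUpTo⁺ _ i<r

  ∈-sortedLetters⁻ : ∀ {x} → x ∈ sortedLetters L → x ∈ L
  ∈-sortedLetters⁻ x∈ with ∈-applyUpTo⁻ _ x∈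
  ... | i , i<r , refl = proj₁ (select-spec L N (s≤s z≤n) i<r)

  app-sortedLetters-rank : ∀ {x} → x ∈ L → app (sortedLetters L) (rank L x) ≡ x
  app-sortedLetters-rank x∈L = trans (app-sortedLetters (rank-pos x∈L) (rank-mono L (≤-maxL x∈L))) (select-rank x∈L)

  sortedLetters-increasing : Linked _<_ (sortedLetters L)
  sortedLetters-increasing = applyUpTo⁺₁ _ _ λ {i} 1+i<r →
    rank-<⇒< L (subst₂ _<_ (sym (proj₂ (select-spec L N (s≤s z≤n) (<⇒≤ 1+i<r))))
                           (sym (proj₂ (select-spec L N (s≤s z≤n) 1+i<r))) ≤-refl)

surj-rank : ∀ W ys → (∀ {x} → x ∈ ys → x ∈ W) → (∀ {x} → x ∈ W → x ∈ ys) →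
            Surj (map (rank W) ys) (rank W (maxL W))
surj-rank W ys ys⊆W W⊆ys = All.tabulate bounds , onto
  where
  bounds : ∀ {y} → y ∈ map (rank W) ys → 1 ≤ y × y ≤ rank W (maxL W)
  bounds y∈ with ∈-map⁻ (rank W) y∈
  ... | x , x∈ys , refl = rank-pos (ys⊆W x∈ys) , rank-mono W (≤-maxL (ys⊆W x∈ys))
  onto : ∀ j → 1 ≤ j → j ≤ rank W (maxL W) → j ∈ map (rank W) ys
  onto j 1≤j j≤r with select-spec W (suc (maxL W)) 1≤j j≤r
  ... | x∈W , rank-x = subst (_∈ map (rank W) ys) rank-x (∈-map⁺ (rank W) (W⊆ys x∈W))

module _ {A : Set} where

  take-length-++ : ∀ (xs ys : List A) → take (length xs) (xs ++ ys) ≡ xs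
  take-length-++ []       ys = refl
  take-length-++ (x ∷ xs) ys = cong (x ∷_) (take-length-++ xs ys)

  drop-length-++ : ∀ (xs ys : List A) → drop (length xs) (xs ++ ys) ≡ ys
  drop-length-++ []       ys = refl
  drop-length-++ (x ∷ xs) ys = drop-length-++ xs ys

Cmp-strictMonoOn : ∀ op {xs g x y} → StrictlyMonotoneOn xs g → x ∈ xs → y ∈ xs →
                   Cmp op x y → Cmp op (g x) (g y)
Cmp-strictMonoOn ≻op mono x∈ y∈ x<y = mono x∈ y∈ x<y
Cmp-strictMonoOn ·op mono x∈ y∈ refl = refl
Cmp-strictMonoOn ≺op mono x∈ y∈ y<x = mono y∈ x∈ y<x

module Shuffle (u v : List ℕ) where

  W : List ℕ
  W = u ++ v

  r s : ℕ
  r = rank u (maxL u)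
  s = rank v (maxL v)

  σᵤ σᵥ σ : List ℕ
  σᵤ = map (rank W) (sortedLetters u)
  σᵥ = map (rank W) (sortedLetters v)
  σ  = σᵤ ++ σᵥ

  private
    ∣σᵤ∣ : length σᵤ ≡ r
    ∣σᵤ∣ = trans (length-map (rank W) (sortedLetters u)) (length-sortedLetters u)

    ∣σᵥ∣ : length σᵥ ≡ s
    ∣σᵥ∣ = trans (length-map (rank W) (sortedLetters v)) (length-sortedLetters v)

    W-mono : StrictlyMonotoneOn W (rank W)
    W-mono = rank-strictMonoOn W

  σ-left : ∀ {x} → x ∈ u → app σ (rank u x) ≡ rank W x
  σ-left {x} x∈u with rank u x | rank-pos x∈u | rank-mono u (≤-maxL x∈u) | app-sortedLetters-rank x∈u
  ... | suc i | _ | i<r | app-i≡x = begin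
    app (σᵤ ++ σᵥ) (suc i)                  ≡⟨ app-++ˡ σᵤ σᵥ (subst (i <_) (sym ∣σᵤ∣) i<r) ⟩
    app σᵤ (suc i)                          ≡⟨ app-map (rank W) (sortedLetters u)
                                                 (subst (i <_) (sym (length-sortedLetters u)) i<r) ⟩
    rank W (app (sortedLetters u) (suc i))  ≡⟨ cong (rank W) app-i≡x ⟩
    rank W x                                ∎
    where open ≡-Reasoning

  σ-right : ∀ {x} → x ∈ v → app σ (r + rank v x) ≡ rank W x
  σ-right {x} x∈v with rank v x | rank-pos x∈v | rank-mono v (≤-maxL x∈v) | app-sortedLetters-rank x∈v
  ... | suc i | _ | i<s | app-i≡x = begin
    app (σᵤ ++ σᵥ) (r + suc i)              ≡⟨ cong (app σ) (trans (+-suc r i)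
                                                   (cong (λ k → suc (k + i)) (sym ∣σᵤ∣))) ⟩
    app (σᵤ ++ σᵥ) (suc (length σᵤ + i))    ≡⟨ app-++ʳ σᵤ σᵥ i ⟩
    app σᵥ (suc i)                          ≡⟨ app-map (rank W) (sortedLetters v)
                                                 (subst (i <_) (sym (length-sortedLetters v)) i<s) ⟩
    rank W (app (sortedLetters v) (suc i))  ≡⟨ cong (rank W) app-i≡x ⟩
    rank W x                                ∎
    where open ≡-Reasoning

  σ-∘ₚ-ranks : σ ∘ₚ (map (rank u) u ×[ r ] map (rank v) v) ≡ map (rank W) W
  σ-∘ₚ-ranks = begin
    map (app σ) (map (rank u) u ++ map (_+ r) (map (rank v) v))
      ≡⟨ map-++ (app σ) (map (rank u) u) _ ⟩
    map (app σ) (map (rank u) u) ++ map (app σ) (map (_+ r) (map (rank v) v))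
      ≡⟨ cong₂ _++_ (trans (sym (map-∘ u)) (map-cong-local (All.tabulate σ-left)))
                    (trans (sym (trans (map-∘ v) (map-∘ (map (rank v) v))))
                           (map-cong-local (All.tabulate λ {x} x∈v →
                             trans (cong (app σ) (+-comm (rank v x) r)) (σ-right x∈v)))) ⟩
    map (rank W) u ++ map (rank W) v
      ≡⟨ sym (map-++ (rank W) u v) ⟩
    map (rank W) W ∎
    where open ≡-Reasoning

  σ-shuffle : SH r s σ
  σ-shuffle = (rank W (maxL W) , subst (λ σ′ → Surj σ′ (rank W (maxL W)))
                                   (map-++ (rank W) (sortedLetters u) (sortedLetters v))
                                   (surj-rank W (sortedLetters u ++ sortedLetters v) letters⊆W W⊆letters))
            , trans (length-++ σᵤ) (cong₂ _+_ ∣σᵤ∣ ∣σᵥ∣)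
            , subst (Linked _<_ ∘ (λ k → take k σ)) ∣σᵤ∣ (subst (Linked _<_) (sym (take-length-++ σᵤ σᵥ))
                (Linked-map (strictMonoOn-⊆ (∈-++⁺ˡ ∘ ∈-sortedLetters⁻ {u}) W-mono) (sortedLetters-increasing {u})))
            , subst (Linked _<_ ∘ (λ k → drop k σ)) ∣σᵤ∣ (subst (Linked _<_) (sym (drop-length-++ σᵤ σᵥ))
                (Linked-map (strictMonoOn-⊆ (∈-++⁺ʳ u ∘ ∈-sortedLetters⁻ {v}) W-mono) (sortedLetters-increasing {v})))
    where
    letters⊆W : ∀ {x} → x ∈ sortedLetters u ++ sortedLetters v → x ∈ W
    letters⊆W x∈ with ∈-++⁻ (sortedLetters u) x∈
    ... | inj₁ x∈u = ∈-++⁺ˡ (∈-sortedLetters⁻ {u} x∈u)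
    ... | inj₂ x∈v = ∈-++⁺ʳ u (∈-sortedLetters⁻ {v} x∈v)
    W⊆letters : ∀ {x} → x ∈ W → x ∈ sortedLetters u ++ sortedLetters v
    W⊆letters x∈ with ∈-++⁻ u x∈
    ... | inj₁ x∈u = ∈-++⁺ˡ (∈-sortedLetters⁺ x∈u)
    ... | inj₂ x∈v = ∈-++⁺ʳ (sortedLetters u) (∈-sortedLetters⁺ x∈v)

  σ-cmp : ∀ op → maxL u ∈ u → maxL v ∈ v → Cmp op (maxL u) (maxL v) → Cmp op (app σ r) (app σ (r + s))
  σ-cmp op Mu∈u Mv∈v c = subst₂ (Cmp op) (sym (σ-left Mu∈u)) (sym (σ-right Mv∈v))
    (Cmp-strictMonoOn op W-mono (∈-++⁺ˡ Mu∈u) (∈-++⁺ʳ u Mv∈v) c)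

concat⇒inSet : ∀ {op t z w} → t ≢ leaf → z ≢ leaf → Concat op t z w → InSet op t z w
concat⇒inSet t≢leaf _ ([] , _ , tu , _) = contradiction (sym tu) t≢leaf
concat⇒inSet _ z≢leaf (_ , [] , _ , tv , _) = contradiction (sym tv) z≢leaf
concat⇒inSet {op} _ _ (u@(x ∷ xs) , v@(y ∷ ys) , tu , tv , c , tuv) =
  map (rank u) u , r , map (rank v) v , s , σ
  , surj-rank u u id id , Γ-standard u tu
  , surj-rank v v id id , Γ-standard v tv
  , (σ-shuffle , σ-cmp op (maxL-∈ x xs) (maxL-∈ y ys) c)
  , trans (Γ≡tree (σ ∘ₚ (map (rank u) u ×[ r ] map (rank v) v)))
          (trans (cong tree σ-∘ₚ-ranks) (trans (tree-relabel W (rank-strictMonoOn W)) tuv))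
  where
  open Shuffle u v
  Γ-standard : ∀ {t} L → tree L ≡ t → Γ (map (rank L) L) ≡ t
  Γ-standard L tL = trans (Γ≡tree (map (rank L) L)) (trans (tree-relabel L (rank-strictMonoOn L)) tL)

Surj⇒0< : ∀ {c γ r} → Surj (c ∷ γ) r → 0 < r
Surj⇒0< ((1≤c , c≤r) ∷ _ , _) = ≤-trans 1≤c c≤r

Surj⇒maxL : ∀ {c γ r} → Surj (c ∷ γ) r → maxL (c ∷ γ) ≡ r
Surj⇒maxL (bounds@((1≤c , c≤r) ∷ _) , onto) =
  ≤-antisym (maxL≤ (All.map proj₂ bounds)) (≤-maxL (onto _ (≤-trans 1≤c c≤r) ≤-refl))

app-strictMonoOn : ∀ {xs ys} → Linked _<_ xs → All (λ x → 1 ≤ x × x ≤ length xs) ys →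
                   StrictlyMonotoneOn ys (app xs)
app-strictMonoOn incr bounds x∈ y∈ x<y with All.lookup bounds x∈ | All.lookup bounds y∈ | x<y
... | s≤s z≤n , _ | s≤s z≤n , y≤n | s≤s i<j = Linked-app incr i<j y≤n

module Unshuffle {σ : List ℕ} {r s : ℕ} (∣σ∣ : length σ ≡ r + s)
                 (incrₗ : Increasing (take r σ)) (incrᵣ : Increasing (drop r σ)) where

  σₗ σᵣ : List ℕ
  σₗ = take r σ
  σᵣ = drop r σ

  private
    ∣σₗ∣ : length σₗ ≡ r
    ∣σₗ∣ = trans (length-take r σ) (trans (cong (r ⊓_) ∣σ∣) (m≤n⇒m⊓n≡m (m≤m+n r s)))

    ∣σᵣ∣ : length σᵣ ≡ s
    ∣σᵣ∣ = trans (length-drop r σ) (trans (cong (_∸ r) ∣σ∣) (m+n∸m≡n r s))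

  strictMonoOnₗ : ∀ {γ} → Surj γ r → StrictlyMonotoneOn γ (app σₗ)
  strictMonoOnₗ (bounds , _) =
    app-strictMonoOn incrₗ (All.map (λ (1≤x , x≤r) → 1≤x , subst (_ ≤_) (sym ∣σₗ∣) x≤r) bounds)

  strictMonoOnᵣ : ∀ {δ} → Surj δ s → StrictlyMonotoneOn δ (app σᵣ)
  strictMonoOnᵣ (bounds , _) =
    app-strictMonoOn incrᵣ (All.map (λ (1≤x , x≤s) → 1≤x , subst (_ ≤_) (sym ∣σᵣ∣) x≤s) bounds)

  maxL-left : ∀ {c γ} → Surj (c ∷ γ) r → maxL (map (app σₗ) (c ∷ γ)) ≡ app σ r
  maxL-left {c} {γ} surjγ = begin
    maxL (map (app σₗ) (c ∷ γ))  ≡⟨ maxL-map c γ (strictMonoOnₗ surjγ) ⟩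
    app σₗ (maxL (c ∷ γ))        ≡⟨ cong (app σₗ) (Surj⇒maxL surjγ) ⟩
    app σₗ r                     ≡⟨ app-take r σ (Surj⇒0< surjγ) ≤-refl ⟩
    app σ r                      ∎
    where open ≡-Reasoning

  maxL-right : ∀ {d δ} → Surj (d ∷ δ) s → maxL (map (app σᵣ) (d ∷ δ)) ≡ app σ (r + s)
  maxL-right {d} {δ} surjδ = begin
    maxL (map (app σᵣ) (d ∷ δ))  ≡⟨ maxL-map d δ (strictMonoOnᵣ surjδ) ⟩
    app σᵣ (maxL (d ∷ δ))        ≡⟨ cong (app σᵣ) (Surj⇒maxL surjδ) ⟩
    app σᵣ s                     ≡⟨ app-drop r σ (Surj⇒0< surjδ) ⟩
    app σ (r + s)                ∎
    where open ≡-Reasoning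

  ∘ₚ-× : ∀ {γ δ} → Surj γ r → Surj δ s → σ ∘ₚ (γ ×[ r ] δ) ≡ map (app σₗ) γ ++ map (app σᵣ) δ
  ∘ₚ-× {γ} {δ} (γ-bounds , _) (δ-bounds , _) = begin
    map (app σ) (γ ++ map (_+ r) δ)              ≡⟨ map-++ (app σ) γ (map (_+ r) δ) ⟩
    map (app σ) γ ++ map (app σ) (map (_+ r) δ)  ≡⟨ cong₂ _++_ (map-cong-local (All.map on-left γ-bounds))
                                                      (trans (sym (map-∘ δ)) (map-cong-local (All.map on-right δ-bounds))) ⟩
    map (app σₗ) γ ++ map (app σᵣ) δ             ∎
    where
    open ≡-Reasoning
    on-left : ∀ {x} → 1 ≤ x × x ≤ r → app σ x ≡ app σₗ x
    on-left (0<x , x≤r) = sym (app-take r σ 0<x x≤r)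
    on-right : ∀ {x} → 1 ≤ x × x ≤ s → app σ (x + r) ≡ app σᵣ x
    on-right {x} (0<x , _) = trans (cong (app σ) (+-comm x r)) (sym (app-drop r σ 0<x))

inSet⇒concat : ∀ {op t z w} → t ≢ leaf → z ≢ leaf → InSet op t z w → Concat op t z w
inSet⇒concat t≢leaf _ ([] , _ , _ , _ , _ , _ , Γγ , _) = contradiction (sym Γγ) t≢leaf
inSet⇒concat _ z≢leaf (_ ∷ _ , _ , [] , _ , _ , _ , _ , _ , Γδ , _) = contradiction (sym Γδ) z≢leaf
inSet⇒concat {op} _ _ (γ@(_ ∷ _) , r , δ@(_ ∷ _) , s , σ , surjγ , Γγ , surjδ , Γδ
                      , ((_ , ∣σ∣ , incrₗ , incrᵣ) , cmp) , Γw) =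
  map (app σₗ) γ , map (app σᵣ) δ
  , trans (tree-relabel γ (strictMonoOnₗ surjγ)) (trans (sym (Γ≡tree γ)) Γγ)
  , trans (tree-relabel δ (strictMonoOnᵣ surjδ)) (trans (sym (Γ≡tree δ)) Γδ)
  , subst₂ (Cmp op) (sym (maxL-left surjγ)) (sym (maxL-right surjδ)) cmp
  , trans (cong tree (sym (∘ₚ-× surjγ surjδ))) (trans (sym (Γ≡tree (σ ∘ₚ (γ ×[ r ] δ)))) Γw)
  where open Unshuffle ∣σ∣ incrₗ incrᵣ

inSet⇔concat : ∀ {op t z w} → t ≢ leaf → z ≢ leaf → InSet op t z w ⇔ Concat op t z w
inSet⇔concat t≢leaf z≢leaf = mk⇔ (inSet⇒concat t≢leaf z≢leaf) (concat⇒inSet t≢leaf z≢leaf)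

-- Leaf counts, disjointness and decidability

leafCount  : Tree → ℕ
leafCounts : List Tree → ℕ
leafCount leaf       = 1
leafCount (⋁ a b cs) = leafCount a + (leafCount b + leafCounts cs)
leafCounts []       = 0
leafCounts (c ∷ cs) = leafCount c + leafCounts cs

leafCount-pos : ∀ t → 0 < leafCount t
leafCount-pos leaf       = s≤s z≤n
leafCount-pos (⋁ a b cs) = ≤-trans (leafCount-pos a) (m≤m+n _ _)

∈⇒leafCount≤leafCounts : ∀ {c cs} → c ∈ cs → leafCount c ≤ leafCounts cs
∈⇒leafCount≤leafCounts (here refl) = m≤m+n _ _
∈⇒leafCount≤leafCounts (there c∈) = ≤-trans (∈⇒leafCount≤leafCounts c∈) (m≤n+m _ _)

∈-children⇒leafCount< : ∀ {c} w → c ∈ children w → leafCount c < leafCount w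
∈-children⇒leafCount< (⋁ a b cs) (here refl)         = m<m+n _ (≤-trans (leafCount-pos b) (m≤m+n _ _))
∈-children⇒leafCount< (⋁ a b cs) (there (here refl)) = ≤-<-trans (m≤m+n _ _) (m<n+m _ (leafCount-pos a))
∈-children⇒leafCount< (⋁ a b cs) (there (there c∈)) =
  ≤-<-trans (≤-trans (∈⇒leafCount≤leafCounts c∈) (m≤n+m _ _)) (m<n+m _ (leafCount-pos a))

leafCount-node : ∀ {w} → children w ≢ [] → leafCount w ≡ leafCounts (children w)
leafCount-node {leaf}      ch≢[] = contradiction refl ch≢[]
leafCount-node {⋁ _ _ _} _     = refl

leafCounts-intercalate : ∀ m s S → (∀ {s′} → s′ ∈ s ∷ S → leafCount (tree s′) ≡ suc (length s′)) →
                         leafCounts (map tree (s ∷ S)) ≡ suc (length (intercalate [ m ] (s ∷ S)))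
leafCounts-intercalate m s []        count = trans (+-identityʳ _) (count (here refl))
leafCounts-intercalate m s (s′ ∷ S) count = begin
  leafCount (tree s) + leafCounts (map tree (s′ ∷ S))
    ≡⟨ cong₂ _+_ (count (here refl)) (leafCounts-intercalate m s′ S (count ∘ there)) ⟩
  suc (length s) + suc (length (intercalate [ m ] (s′ ∷ S)))
    ≡⟨ cong suc (sym (length-++ s)) ⟩
  suc (length (s ++ m ∷ intercalate [ m ] (s′ ∷ S))) ∎
  where open ≡-Reasoning

leafCount-tree : ∀ xs → leafCount (tree xs) ≡ suc (length xs)
leafCount-tree xs = bounded (length xs) xs ≤-refl
  where
  bounded : ∀ n xs → length xs ≤ n → leafCount (tree xs) ≡ suc (length xs)
  bounded _       []       _ = refl
  bounded (suc n) (x ∷ xs) (s≤s ∣xs∣≤n) with maxL-segments x xs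
  ... | [] , () , _
  ... | s ∷ S , xs≡ , _ , 1<∣S∣ , eqS = begin
    leafCount (tree (x ∷ xs))                  ≡⟨ leafCount-node (λ ch≡[] → map≢[] (trans eqS ch≡[])) ⟩
    leafCounts (children (tree (x ∷ xs)))      ≡⟨ cong leafCounts (sym eqS) ⟩
    leafCounts (map tree (s ∷ S))              ≡⟨ leafCounts-intercalate M s S
                                                    (λ {s′} s′∈ → bounded n s′ (∣s′∣≤n s′∈)) ⟩
    suc (length (intercalate [ M ] (s ∷ S)))   ≡⟨ cong (suc ∘ length) xs≡ ⟩
    suc (length (x ∷ xs))                      ∎
    where
    open ≡-Reasoning
    M = maxL (x ∷ xs)
    map≢[] : map tree (s ∷ S) ≢ []
    map≢[] ()
    ∣s′∣≤n : ∀ {s′} → s′ ∈ s ∷ S → length s′ ≤ n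
    ∣s′∣≤n {s′} s′∈ = ≤-trans (≤-pred (subst (length s′ <_) (cong length xs≡)
                                       (length-∈-intercalate (s ∷ S) 1<∣S∣ s′∈))) ∣xs∣≤n

anyConcat⇒leafCount≤ : ∀ {t z y} → AnyConcat t z y → leafCount t ≤ leafCount y
anyConcat⇒leafCount≤ (u , v , refl , _ , refl) rewrite leafCount-tree u | leafCount-tree (u ++ v) | length-++ u {v} =
  s≤s (m≤m+n _ _)

¬anyConcat-child : ∀ {t z c} → c ∈ children t → ¬ AnyConcat t z c
¬anyConcat-child c∈ tzc = <⇒≱ (∈-children⇒leafCount< _ c∈) (anyConcat⇒leafCount≤ tzc)

module _ {t t₀ : Tree} {tm : List Tree} {tk z₀ z₁ : Tree} {zs : List Tree} {w : Tree}
         (ch-t : children t ≡ t₀ ∷ tm ++ [ tk ]) where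

  private
    ¬anyConcat-t₀ : ¬ AnyConcat t z₀ t₀
    ¬anyConcat-t₀ = ¬anyConcat-child (subst (t₀ ∈_) (sym ch-t) (here refl))

  concat≻·-disjoint : ¬ (Concat ≻op t (⋁ z₀ z₁ zs) w × Concat ·op t (⋁ z₀ z₁ zs) w)
  concat≻·-disjoint (c≻ , c·) with concat≻-shape c≻ | concat·-shape ch-t c·
  ... | y , ch , tz₀y | _ , ch′ , _ with ∷-injective (trans (sym ch) ch′)
  ...   | refl , _ = ¬anyConcat-t₀ tz₀y

  concat≻≺-disjoint : ¬ (Concat ≻op t (⋁ z₀ z₁ zs) w × Concat ≺op t (⋁ z₀ z₁ zs) w)
  concat≻≺-disjoint (c≻ , c≺) with concat≻-shape c≻ | concat≺-shape ch-t c≺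
  ... | y , ch , tz₀y | _ , ch′ , _ with ∷-injective (trans (sym ch) ch′)
  ...   | refl , _ = ¬anyConcat-t₀ tz₀y

  concat·≺-disjoint : ¬ (Concat ·op t (⋁ z₀ z₁ zs) w × Concat ≺op t (⋁ z₀ z₁ zs) w)
  concat·≺-disjoint (c· , c≺) with concat·-shape ch-t c· | concat≺-shape ch-t c≺
  ... | _ , ch , _ | _ , ch′ , _ with ∷-injective (++-cancelˡ (t₀ ∷ tm) _ _ (trans (sym ch) ch′))
  ...   | _ , ()

module _ {Q : Tree → Set} {Z : List Tree} where

  framed-[]-∷ : ∀ {w ws} → Framed [] Z Q (w ∷ ws) ⇔ (Q w × ws ≡ Z)
  framed-[]-∷ = mk⇔ (λ { (_ , refl , q) → q , refl }) (λ { (q , refl) → _ , refl , q })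

  framed-∷-∷ : ∀ {t T w ws} → Framed (t ∷ T) Z Q (w ∷ ws) ⇔ (w ≡ t × Framed T Z Q ws)
  framed-∷-∷ = mk⇔ (λ { (y , refl , q) → refl , y , refl , q }) (λ { (refl , y , refl , q) → y , refl , q })

framed? : ∀ {Q : Tree → Set} → (∀ y → Dec (Q y)) → ∀ T Z ws → Dec (Framed T Z Q ws)
framed? Q? []      Z []       = no λ ()
framed? Q? (t ∷ T) Z []       = no λ ()
framed? Q? []      Z (w ∷ ws) = Dec.map (⇔-sym framed-[]-∷) (Q? w ×-dec (ws ≟ᴸ Z))
framed? Q? (t ∷ T) Z (w ∷ ws) = Dec.map (⇔-sym framed-∷-∷) ((w ≟ᵀ t) ×-dec framed? Q? T Z ws)

[]≢++-∷ : ∀ {A : Set} (xs : List A) {y ys} → [] ≢ xs ++ y ∷ ys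
[]≢++-∷ []      ()
[]≢++-∷ (_ ∷ _) ()

∷-∷ʳ-view : ∀ {A : Set} (b : A) cs → ∃₂ λ xs x → b ∷ cs ≡ xs ++ [ x ]
∷-∷ʳ-view b []       = [] , b , refl
∷-∷ʳ-view b (c ∷ cs) with ∷-∷ʳ-view c cs
... | xs , x , eq = b ∷ xs , x , cong (b ∷_) eq

anyConcat? : ∀ t z y → Dec (AnyConcat t z y)
anyConcat? t z = bounded (leafCount t + leafCount z) t z ≤-refl
  where
  bounded : ∀ n t z → leafCount t + leafCount z ≤ n → ∀ y → Dec (AnyConcat t z y)
  bounded n leaf z _ y = Dec.map (⇔-sym anyConcat-leafˡ) (y ≟ᵀ z)
  bounded n t@(⋁ _ _ _) leaf _ y = Dec.map (⇔-sym anyConcat-leafʳ) (y ≟ᵀ t)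
  bounded zero t@(⋁ _ _ _) (⋁ _ _ _) size _ =
    contradiction (≤-trans (leafCount-pos t) (≤-trans (m≤m+n _ _) size)) λ ()
  bounded (suc n) t@(⋁ a b cs) z@(⋁ z₀ z₁ zs) size y with ∷-∷ʳ-view b cs
  ... | tm , tk , eq = Dec.map (⇔-sym anyConcat⇔concat) ((D≻ ⊎-dec D·) ⊎-dec D≺)
    where
    ch-t : children t ≡ a ∷ tm ++ [ tk ]
    ch-t = cong (a ∷_) eq
    tk<t : leafCount tk < leafCount t
    tk<t = ∈-children⇒leafCount< t (subst (tk ∈_) (sym ch-t) (∈-++⁺ʳ (a ∷ tm) (here refl)))
    z₀<z : leafCount z₀ < leafCount z
    z₀<z = ∈-children⇒leafCount< z (here refl)
    D≻ : Dec (Concat ≻op t z y)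
    D≻ = Dec.map (⇔-sym concat≻⇔framed)
      (framed? (bounded n t z₀ (≤-pred (≤-trans (+-monoʳ-< (leafCount t) z₀<z) size))) [] (z₁ ∷ zs) (children y))
    D· : Dec (Concat ·op t z y)
    D· = Dec.map (⇔-sym (concat·⇔framed ch-t))
      (framed? (bounded n tk z₀ (≤-pred (≤-trans (+-mono-< tk<t z₀<z) size))) (a ∷ tm) (z₁ ∷ zs) (children y))
    D≺ : Dec (Concat ≺op t z y)
    D≺ = Dec.map (⇔-sym (concat≺⇔framed ch-t))
      (framed? (bounded n tk z (≤-pred (≤-trans (+-monoˡ-< (leafCount z) tk<t) size))) (a ∷ tm) [] (children y))

-- Indicator vectors

module Indicators {c ℓ} (F : Field c ℓ) where

  module K = Field F
  open K using (Carrier; _≈_; 0#; 1#)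
    renaming (_+_ to _+ₖ_; _*_ to _*ₖ_; refl to ≈-refl; sym to ≈-sym; trans to ≈-trans)
  open Lin F

  Indicates : Set → Carrier → Set ℓ
  Indicates P x = (P → x ≈ 1#) × (¬ P → x ≈ 0#)

  indicates-⇔ : ∀ {P Q x} → P ⇔ Q → Indicates P x → Indicates Q x
  indicates-⇔ P⇔Q (x≈1 , x≈0) = x≈1 ∘ Equivalence.from P⇔Q , λ ¬q → x≈0 (¬q ∘ Equivalence.to P⇔Q)

  module _ {P Q : Set} {x y : Carrier} where

    *-indicates : Dec P → Indicates P x → Indicates Q y → Indicates (P × Q) (x *ₖ y)
    *-indicates (yes p) (x≈1 , _) (y≈1 , y≈0) =
      (λ (_ , q) → ≈-trans (K.*-cong (x≈1 p) (y≈1 q)) (K.*-identityˡ 1#)) ,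
      (λ ¬pq → ≈-trans (K.*-cong ≈-refl (y≈0 (λ q → ¬pq (p , q)))) (K.zeroʳ x))
    *-indicates (no ¬p) (_ , x≈0) _ =
      (λ (p , _) → contradiction p ¬p) , (λ _ → ≈-trans (K.*-cong (x≈0 ¬p) ≈-refl) (K.zeroˡ y))

    +-indicates : ¬ (P × Q) → Indicates P x → Indicates Q y → Indicates (P ⊎ Q) (x +ₖ y)
    +-indicates disjoint (x≈1 , x≈0) (y≈1 , y≈0) = one , none
      where
      one : P ⊎ Q → x +ₖ y ≈ 1#
      one (inj₁ p) = ≈-trans (K.+-cong (x≈1 p) (y≈0 λ q → disjoint (p , q))) (K.+-identityʳ 1#)
      one (inj₂ q) = ≈-trans (K.+-cong (x≈0 λ p → disjoint (p , q)) (y≈1 q)) (K.+-identityˡ 1#)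
      none : ¬ (P ⊎ Q) → x +ₖ y ≈ 0#
      none ¬p⊎q = ≈-trans (K.+-cong (x≈0 (¬p⊎q ∘ inj₁)) (y≈0 (¬p⊎q ∘ inj₂))) (K.+-identityʳ 0#)

  indicates-unique : ∀ {P : Set} {x y} → Dec P → Indicates P x → Indicates P y → x ≈ y
  indicates-unique (yes p) (x≈1 , _) (y≈1 , _) = ≈-trans (x≈1 p) (≈-sym (y≈1 p))
  indicates-unique (no ¬p) (_ , x≈0) (_ , y≈0) = ≈-trans (x≈0 ¬p) (≈-sym (y≈0 ¬p))

  bas-indicates : ∀ t w → Indicates (w ≡ t) (bas t w)
  bas-indicates t w with w ≟ᵀ t
  ... | yes w≡t = (λ _ → ≈-refl) , (λ w≢t → contradiction w≡t w≢t)
  ... | no w≢t  = (λ w≡t → contradiction w≡t w≢t) , (λ _ → ≈-refl)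

  coeffs-bas-indicates : ∀ Z ws → Indicates (ws ≡ Z) (coeffs (map bas Z) ws)
  coeffs-bas-indicates []      []       = (λ _ → ≈-refl) , (λ []≢[] → contradiction refl []≢[])
  coeffs-bas-indicates []      (_ ∷ _)  = (λ ()) , (λ _ → ≈-refl)
  coeffs-bas-indicates (_ ∷ _) []       = (λ ()) , (λ _ → ≈-refl)
  coeffs-bas-indicates (z ∷ Z) (w ∷ ws) =
    indicates-⇔ (mk⇔ (λ { (refl , refl) → refl }) ∷-injective)
      (*-indicates (w ≟ᵀ z) (bas-indicates z w) (coeffs-bas-indicates Z ws))

  module _ {Q : Tree → Set} (Q? : ∀ y → Dec (Q y)) {A : V} (A-indicates : ∀ y → Indicates (Q y) (A y)) where

    coeffs-framed-indicates : ∀ T Z ws → Indicates (Framed T Z Q ws) (coeffs (map bas T ++ A ∷ map bas Z) ws)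
    coeffs-framed-indicates []      Z []       = (λ ()) , (λ _ → ≈-refl)
    coeffs-framed-indicates (_ ∷ _) Z []       = (λ ()) , (λ _ → ≈-refl)
    coeffs-framed-indicates []      Z (w ∷ ws) =
      indicates-⇔ (⇔-sym framed-[]-∷) (*-indicates (Q? w) (A-indicates w) (coeffs-bas-indicates Z ws))
    coeffs-framed-indicates (t ∷ T) Z (w ∷ ws) =
      indicates-⇔ (⇔-sym framed-∷-∷) (*-indicates (w ≟ᵀ t) (bas-indicates t w) (coeffs-framed-indicates T Z ws))

    ⋁ᵥ-framed-indicates : ∀ T Z → IsIndicator (Framed T Z Q ∘ children) (⋁ᵥ (map bas T ++ A ∷ map bas Z))
    ⋁ᵥ-framed-indicates T Z leaf       = (λ (_ , []≡ , _) → contradiction []≡ ([]≢++-∷ T)) , (λ _ → ≈-refl)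
    ⋁ᵥ-framed-indicates T Z (⋁ a b cs) = coeffs-framed-indicates T Z (a ∷ b ∷ cs)

-- The three products of planar trees

module Products {c ℓ} (F : Field c ℓ) (I : Op → Tree → Tree → Lin.V F)
  (hyp : ∀ op a₀ a₁ as b₀ b₁ bs →
     Lin.IsIndicator F (InSet op (⋁ a₀ a₁ as) (⋁ b₀ b₁ bs)) (I op (⋁ a₀ a₁ as) (⋁ b₀ b₁ bs))) where

  open Lin F
  open Indicators F

  concat-indicates : ∀ op {t z} → t ≢ leaf → z ≢ leaf → IsIndicator (Concat op t z) (I op t z)
  concat-indicates op {leaf}       t≢leaf _      = contradiction refl t≢leaf
  concat-indicates op {⋁ _ _ _} {leaf} _ z≢leaf = contradiction refl z≢leaf
  concat-indicates op {⋁ a₀ a₁ as} {⋁ b₀ b₁ bs} t≢leaf z≢leaf w =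
    indicates-⇔ (inSet⇔concat t≢leaf z≢leaf) (hyp op a₀ a₁ as b₀ b₁ bs w)

  star-indicates : ∀ t z → IsIndicator (AnyConcat t z) (star I t z)
  star-indicates leaf z w = indicates-⇔ (⇔-sym anyConcat-leafˡ) (bas-indicates z w)
  star-indicates t@(⋁ _ _ _) leaf w = indicates-⇔ (⇔-sym anyConcat-leafʳ) (bas-indicates t w)
  star-indicates t@(⋁ a b cs) z@(⋁ z₀ z₁ zs) w with ∷-∷ʳ-view b cs
  ... | tm , tk , eq = indicates-⇔ (⇔-sym anyConcat⇔concat)
        (+-indicates disjoint (+-indicates (concat≻·-disjoint ch-t) (ind ≻op) (ind ·op)) (ind ≺op))
    where
    ch-t : children t ≡ a ∷ tm ++ [ tk ]
    ch-t = cong (a ∷_) eq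
    ind : ∀ op → Indicates (Concat op t z w) (I op t z w)
    ind op = concat-indicates op (λ ()) (λ ()) w
    disjoint : ¬ ((Concat ≻op t z w ⊎ Concat ·op t z w) × Concat ≺op t z w)
    disjoint (inj₁ c≻ , c≺) = concat≻≺-disjoint ch-t (c≻ , c≺)
    disjoint (inj₂ c· , c≺) = concat·≺-disjoint ch-t (c· , c≺)

  framed-product : ∀ op T Z {t z t′ z′} → t ≢ leaf → z ≢ leaf →
    (∀ {w} → Concat op t z w ⇔ Framed T Z (AnyConcat t′ z′) (children w)) →
    I op t z ≈ᵥ ⋁ᵥ (map bas T ++ star I t′ z′ ∷ map bas Z)
  framed-product op T Z {t′ = t′} {z′} t≢leaf z≢leaf char w =
    indicates-unique (framed? (anyConcat? t′ z′) T Z (children w))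
      (indicates-⇔ char (concat-indicates op t≢leaf z≢leaf w))
      (⋁ᵥ-framed-indicates (anyConcat? t′ z′) (star-indicates t′ z′) T Z w)

mainTheorem17 : ∀ {c ℓ : Level} (F : Field c ℓ) → let open Lin F in
    (I : Op → Tree → Tree → V) →
    (∀ op a₀ a₁ as b₀ b₁ bs →
       IsIndicator (InSet op (⋁ a₀ a₁ as) (⋁ b₀ b₁ bs)) (I op (⋁ a₀ a₁ as) (⋁ b₀ b₁ bs))) →
    -- t = ⋁(t⁰, t¹ … t^{k-1}, tᵏ) with k ≥ 1, z = ⋁(z⁰, z¹, z² … zʰ) with h ≥ 1
    ∀ (t₀ : Tree) (tm : List Tree) (tk : Tree) (z₀ z₁ : Tree) (zs : List Tree) →
    let t = mkNode (t₀ ∷ tm ++ tk ∷ [])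
        z = ⋁ z₀ z₁ zs
    in (I ≻op t z ≈ᵥ ⋁ᵥ (star I t z₀ ∷ map bas (z₁ ∷ zs)))
     × (I ·op t z ≈ᵥ ⋁ᵥ (map bas (t₀ ∷ tm) ++ star I tk z₀ ∷ map bas (z₁ ∷ zs)))
     × (I ≺op t z ≈ᵥ ⋁ᵥ (map bas (t₀ ∷ tm) ++ star I tk z ∷ []))
mainTheorem17 F I hyp t₀ tm tk z₀ z₁ zs =
    framed-product ≻op []        (z₁ ∷ zs) t≢leaf (λ ()) concat≻⇔framed
  , framed-product ·op (t₀ ∷ tm) (z₁ ∷ zs) t≢leaf (λ ()) (concat·⇔framed ch-t)
  , framed-product ≺op (t₀ ∷ tm) []        t≢leaf (λ ()) (concat≺⇔framed ch-t)
  where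
  open Products F I hyp
  ch-t : children (mkNode (t₀ ∷ tm ++ [ tk ])) ≡ t₀ ∷ tm ++ [ tk ]
  ch-t = children-mkNode _ (1<length-∷-++-∷ t₀ tm tk [])
  t≢leaf : mkNode (t₀ ∷ tm ++ [ tk ]) ≢ leaf
  t≢leaf t≡leaf = contradiction (trans (sym (cong children t≡leaf)) ch-t) λ ()
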